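{- Let $S=\{i_1<i_2<\cdots<i_s\}$ be an admissible set. Then there is a polynomial $p_B(n)=p_B(S,n)$, depending on $S$, taking integer values at all integers $n$, such that \[\#P_B(S,n)=p_B(n)\,2^{2n-s-1}\] for every $n$ for which $S$ is $n$-admissible. Moreover, the degree of $p_B(n)$ is $i_s-1$ (and the degree is $0$ when $S=\emptyset$).
   Context: For $n\ge 1$, $B_n$ is the set of signed permutations $\pi=\pi_1\pi_2\cdots\pi_n$, i.e. words with each $\pi_i\in\{ -n,\dots,-1,1,\dots,n\}$ and $\{|\pi_1|,\dots,|\pi_n|\}=\{1,\dots,n\}$. An index $i\in\{2,\dots,n-1\}$ is a peak of $\pi$ if $\pi_{i-1}<\pi_i>\pi_{i+1}$; $P_B(\pi)$ is the set of peaks of $\pi$, and for a set $S$ of integers $P_B(S,n)=\{\pi\in B_n : P_B(\pi)=S\}$. A set $S=\{i_1<\cdots<i_s\}$ is $n$-admissible if $\#P_B(S,n)\neq 0$; "$S$ is admissible" means $S$ is $n$-admissible for some $n$, and statements about admissible $S$ are asserted for every $n$ for which $S$ is $n$-admissible. -}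

module Defs where

open import Data.Nat as ℕ using (ℕ; zero; suc; _∸_; _⊔_)
open import Data.Integer as ℤ using (ℤ; +_; -[1+_]; ∣_∣)
open import Data.Integer.Properties using (_<?_)
open import Data.Rational as ℚ using (ℚ; _/_)
open import Data.List using (List; []; _∷_; _++_; map; concatMap; filter; length; upTo; foldr)
open import Data.List.Properties using (≡-dec)
open import Data.List.Relation.Unary.All using (All)
open import Data.List.Relation.Unary.All using (all?) public
open import Data.List.Membership.DecPropositional ℕ._≟_ using (_∈_; _∈?_)
open import Relation.Nullary using (Dec; yes; no; _×-dec_; ¬_)
open import Data.Product using (Σ)
open import Relation.Binary.PropositionalEquality using (_≡_)

alphabet : ℕ → List ℤ
alphabet n = map (λ k → -[1+ k ]) (upTo n) ++ map (λ k → + suc k) (upTo n)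

words : List ℤ → ℕ → List (List ℤ)
words A zero    = [] ∷ []
words A (suc m) = concatMap (λ a → map (a ∷_) (words A m)) A

-- {|π_1|,...,|π_n|} = {1,...,n}  (given each letter lies in ±[1..n],
-- this is: every k ∈ {1..n} occurs as some |π_i|).
IsSignedPerm : ℕ → List ℤ → Set
IsSignedPerm n w = All (λ k → k ∈ map ∣_∣ w) (map suc (upTo n))

isSignedPerm? : ∀ n w → Dec (IsSignedPerm n w)
isSignedPerm? n w = all? (λ k → k ∈? map ∣_∣ w) (map suc (upTo n))

B : ℕ → List (List ℤ)
B n = filter (isSignedPerm? n) (words (alphabet n) n)

-- Peak set of a word, positions 1-indexed: i is a peak iff
-- 2 ≤ i ≤ n-1 and π_{i-1} < π_i > π_{i+1}.  peaksFrom i w lists the peaks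
-- of w, assuming the first letter of w is at position i.
peakHere : ℕ → ℤ → List ℤ → List ℕ → List ℕ
peakHere i a (b ∷ c ∷ _) acc with (a <? b) ×-dec (c <? b)
... | yes _ = suc i ∷ acc
... | no  _ = acc
peakHere i a _ acc = acc

peaksFrom : ℕ → List ℤ → List ℕ
peaksFrom i []         = []
peaksFrom i (a ∷ rest) = peakHere i a rest (peaksFrom (suc i) rest)

PB : List ℤ → List ℕ
PB w = peaksFrom 1 w

-- #P_B(S,n) for S given as a strictly increasing list i_1 < ... < i_s.
countPB : List ℕ → ℕ → ℕ
countPB S n = length (filter (λ w → ≡-dec ℕ._≟_ (PB w) S) (B n))

-- Polynomials over ℚ as coefficient lists (constant term first).
Poly : Set
Poly = List ℚ

eval : Poly → ℚ → ℚ
eval []       x = ℚ.0ℚ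
eval (c ∷ cs) x = c ℚ.+ x ℚ.* eval cs x

data HasDegree : Poly → ℕ → Set where
  deg-const : ∀ {c} → ¬ (c ≡ ℚ.0ℚ) → HasDegree (c ∷ []) zero
  deg-suc   : ∀ {c cs d} → HasDegree cs d → HasDegree (c ∷ cs) (suc d)

IntegerValued : Poly → Set
IntegerValued p = ∀ (z : ℤ) → Σ ℤ (λ m → eval p (z / 1) ≡ m / 1)

-- max element of a list (0 for the empty list); for S sorted this is i_s.
maxL : List ℕ → ℕ
maxL = foldr _⊔_ 0

module Submission where

-- B_n is enumerated as Bᴵ n by inserting ±1, ±2, …, ±n one at a time
-- (SignedPerms: same elements, no repetitions, so #P_B(S, n) is a sum over Bᴵ n).
-- The splitting theorem (Splitting) says that for statistics f, g depending
-- only on relative order, Σ_{w ∈ B_n} f(w₁…w_a) g(w_{a+1}…w_n) = C(n,a) Σ_{B_a} f Σ_{B_{n-a}} g.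
-- Since the peaks of a concatenation αβ are those of α, those of β shifted,
-- and at most one new peak at |α| or |α|+1 (Peaks), this gives
--   C(n,a) #P(T,a) #P(∅,n-a) = #P(T,n) + #P(T∪{a},n) + #P(T∪{a+1},n)   (PeakCounts),
-- while #P(∅,m) = 2^{2m-1} follows by inserting the extreme letters (Monotone, Peakless).
-- Removing the largest element m = a+1 of S and solving for #P(S,n) gives, by
-- induction, integer coefficients c_j with #P(S,n) 2^{s+1} = (Σ_j c_j C(n,j)) 4^n,
-- the top one c_{m-1} = p_B(S∖{m}, m-1) being nonzero (Recursion).  Finally
-- Σ_j c_j C(x,j) is an integer-valued rational polynomial of degree m-1 (Polynomials).

module Sums where

  open import Data.Nat using (ℕ; zero; suc; _+_; _*_; _^_; _≤_; _<_; z≤n; s≤s; _≟_)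
  open import Data.Nat.Properties
  open import Data.List using (List; []; _∷_; _++_; length; filter)
  open import Data.List.Relation.Unary.All as All using (All; []; _∷_)
  open import Data.List.Relation.Unary.Any using (here; there)
  open import Data.List.Relation.Unary.AllPairs using (AllPairs; []; _∷_)
  open import Data.List.Relation.Unary.Unique.Propositional using (Unique)
  open import Data.List.Membership.Propositional using (_∈_; _∉_)
  import Data.List.Membership.Propositional.Properties as ∈
  open import Data.Product using (Σ; _×_; _,_)
  open import Data.Sum using (inj₁; inj₂)
  open import Data.Empty using (⊥-elim)
  open import Relation.Nullary using (Dec; yes; no; ¬_; _×-dec_)
  open import Relation.Unary using (Decidable)
  open import Relation.Binary.PropositionalEquality
  open import Data.Nat.Solver using (module +-*-Solver)
  open +-*-Solver using (solve; _:+_; _:=_; con)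

  -- Logical equivalence, kept as a plain pair so that both directions can be
  -- projected and rebuilt by pattern matching.
  Iff : Set → Set → Set
  Iff A B = (A → B) × (B → A)

  Iff-refl : ∀ {A : Set} → Iff A A
  Iff-refl = (λ a → a) , (λ a → a)

  Iff-tt : ∀ {A B : Set} → A → B → Iff A B
  Iff-tt a b = (λ _ → b) , (λ _ → a)

  Iff-ff : ∀ {A B : Set} → ¬ A → ¬ B → Iff A B
  Iff-ff na nb = (λ a → ⊥-elim (na a)) , (λ b → ⊥-elim (nb b))

  𝟙 : {P : Set} → Dec P → ℕ
  𝟙 (yes _) = 1
  𝟙 (no _) = 0

  𝟙-yes : {P : Set} (d : Dec P) → P → 𝟙 d ≡ 1
  𝟙-yes (yes _) _ = refl
  𝟙-yes (no ¬p) p = ⊥-elim (¬p p)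

  𝟙-no : {P : Set} (d : Dec P) → ¬ P → 𝟙 d ≡ 0
  𝟙-no (yes p) ¬p = ⊥-elim (¬p p)
  𝟙-no (no _) _ = refl

  𝟙-iff : ∀ {P Q : Set} (p : Dec P) (q : Dec Q) → Iff P Q → 𝟙 p ≡ 𝟙 q
  𝟙-iff (yes _) (yes _) _ = refl
  𝟙-iff (no _) (no _) _ = refl
  𝟙-iff (yes p) (no ¬q) (f , _) = ⊥-elim (¬q (f p))
  𝟙-iff (no ¬p) (yes q) (_ , g) = ⊥-elim (¬p (g q))

  𝟙-× : ∀ {P Q : Set} (p : Dec P) (q : Dec Q) → 𝟙 (p ×-dec q) ≡ 𝟙 p * 𝟙 q
  𝟙-× (yes _) (yes _) = refl
  𝟙-× (yes _) (no _) = refl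
  𝟙-× (no _) (yes _) = refl
  𝟙-× (no _) (no _) = refl

  sumL : {A : Set} → List A → (A → ℕ) → ℕ
  sumL [] f = 0
  sumL (x ∷ xs) f = f x + sumL xs f

  sumL-++ : {A : Set} (xs ys : List A) (f : A → ℕ) → sumL (xs ++ ys) f ≡ sumL xs f + sumL ys f
  sumL-++ [] ys f = refl
  sumL-++ (x ∷ xs) ys f = trans (cong (f x +_) (sumL-++ xs ys f)) (sym (+-assoc (f x) _ _))

  sumL-cong : {A : Set} (xs : List A) {f g : A → ℕ} → All (λ x → f x ≡ g x) xs → sumL xs f ≡ sumL xs g
  sumL-cong [] [] = refl
  sumL-cong (x ∷ xs) (e ∷ es) = cong₂ _+_ e (sumL-cong xs es)

  sumL-ext : {A : Set} (xs : List A) {f g : A → ℕ} → (∀ x → f x ≡ g x) → sumL xs f ≡ sumL xs g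
  sumL-ext xs e = sumL-cong xs (All.tabulate (λ {x} _ → e x))

  private
    interchange : ∀ a b c d → a + b + (c + d) ≡ a + c + (b + d)
    interchange = solve 4 (λ a b c d → (a :+ b) :+ (c :+ d) := (a :+ c) :+ (b :+ d)) refl

  sumL-+ : {A : Set} (xs : List A) (f g : A → ℕ) → sumL xs (λ x → f x + g x) ≡ sumL xs f + sumL xs g
  sumL-+ [] f g = refl
  sumL-+ (x ∷ xs) f g = trans (cong (f x + g x +_) (sumL-+ xs f g)) (interchange (f x) (g x) _ _)

  sumL-twice : {A : Set} (xs : List A) (f : A → ℕ) → sumL xs (λ x → f x + f x) ≡ 2 * sumL xs f
  sumL-twice xs f = trans (sumL-+ xs f f) (cong (sumL xs f +_) (sym (+-identityʳ _)))

  sumL-*ʳ : {A : Set} (xs : List A) (f : A → ℕ) (c : ℕ) → sumL xs (λ x → f x * c) ≡ sumL xs f * c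
  sumL-*ʳ [] f c = refl
  sumL-*ʳ (x ∷ xs) f c = trans (cong (f x * c +_) (sumL-*ʳ xs f c)) (sym (*-distribʳ-+ c (f x) _))

  sumL-*ˡ : {A : Set} (xs : List A) (f : A → ℕ) (c : ℕ) → sumL xs (λ x → c * f x) ≡ c * sumL xs f
  sumL-*ˡ [] f c = sym (*-zeroʳ c)
  sumL-*ˡ (x ∷ xs) f c = trans (cong (c * f x +_) (sumL-*ˡ xs f c)) (sym (*-distribˡ-+ c (f x) _))

  sumL-zero : {A : Set} (xs : List A) → sumL xs (λ _ → 0) ≡ 0
  sumL-zero [] = refl
  sumL-zero (x ∷ xs) = sumL-zero xs

  sumL-nonzero : {A : Set} (xs : List A) (f : A → ℕ) → sumL xs f ≢ 0 → Σ A λ x → x ∈ xs × f x ≢ 0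
  sumL-nonzero [] f ne = ⊥-elim (ne refl)
  sumL-nonzero (x ∷ xs) f ne with f x ≟ 0
  ... | no fx≢0 = x , here refl , fx≢0
  ... | yes fx≡0 with sumL-nonzero xs f (λ e → ne (cong₂ _+_ fx≡0 e))
  ...   | y , y∈xs , fy≢0 = y , there y∈xs , fy≢0

  length-filter-sumL : {A : Set} {P : A → Set} (P? : Decidable P) (xs : List A) →
    length (filter P? xs) ≡ sumL xs (λ x → 𝟙 (P? x))
  length-filter-sumL P? [] = refl
  length-filter-sumL P? (x ∷ xs) with P? x
  ... | yes _ = cong suc (length-filter-sumL P? xs)
  ... | no _ = length-filter-sumL P? xs

  private
    AllPairs-delete : ∀ {A : Set} {R : A → A → Set} (ys : List A) {x zs} →
      AllPairs R (ys ++ x ∷ zs) → AllPairs R (ys ++ zs)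
    AllPairs-delete [] (_ ∷ p) = p
    AllPairs-delete (y ∷ ys) {x} {zs} (a ∷ p) = All-delete ys a ∷ AllPairs-delete ys p
      where
      All-delete : ∀ {P : _ → Set} us → All P (us ++ x ∷ zs) → All P (us ++ zs)
      All-delete [] (_ ∷ q) = q
      All-delete (u ∷ us) (q ∷ qs) = q ∷ All-delete us qs

    Unique-deleted-∉ : ∀ {A : Set} (ys : List A) {x zs} → Unique (ys ++ x ∷ zs) → x ∉ ys ++ zs
    Unique-deleted-∉ [] (a ∷ _) m = All.lookup a m refl
    Unique-deleted-∉ (y ∷ ys) (a ∷ p) (here refl) = All.lookup a (∈.∈-++⁺ʳ ys (here refl)) refl
    Unique-deleted-∉ (y ∷ ys) (a ∷ p) (there m) = Unique-deleted-∉ ys p m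

  sumL-sameElements : {A : Set} (xs ys : List A) (f : A → ℕ) → Unique xs → Unique ys →
    (∀ {z} → z ∈ xs → z ∈ ys) → (∀ {z} → z ∈ ys → z ∈ xs) → sumL xs f ≡ sumL ys f
  sumL-sameElements [] [] f _ _ _ _ = refl
  sumL-sameElements [] (y ∷ ys) f _ _ _ ys⊆ with ys⊆ (here refl)
  ... | ()
  sumL-sameElements (x ∷ xs) ys f (x∉xs ∷ uxs) uys xs⊆ ys⊆ with ∈.∈-∃++ (xs⊆ (here refl))
  ... | ys₁ , ys₂ , refl = begin
      f x + sumL xs f                   ≡⟨ cong (f x +_) (sumL-sameElements xs (ys₁ ++ ys₂) f uxs (AllPairs-delete ys₁ uys) to from) ⟩
      f x + sumL (ys₁ ++ ys₂) f         ≡⟨ cong (f x +_) (sumL-++ ys₁ ys₂ f) ⟩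
      f x + (sumL ys₁ f + sumL ys₂ f)   ≡⟨ x+[y+z]≡y+[x+z] (f x) (sumL ys₁ f) (sumL ys₂ f) ⟩
      sumL ys₁ f + (f x + sumL ys₂ f)   ≡⟨ sym (sumL-++ ys₁ (x ∷ ys₂) f) ⟩
      sumL (ys₁ ++ x ∷ ys₂) f           ∎
    where
    open ≡-Reasoning
    x+[y+z]≡y+[x+z] : ∀ a b c → a + (b + c) ≡ b + (a + c)
    x+[y+z]≡y+[x+z] = solve 3 (λ a b c → a :+ (b :+ c) := b :+ (a :+ c)) refl
    to : ∀ {z} → z ∈ xs → z ∈ ys₁ ++ ys₂
    to m with ∈.∈-++⁻ ys₁ (xs⊆ (there m))
    ... | inj₁ m₁ = ∈.∈-++⁺ˡ m₁
    ... | inj₂ (here refl) = ⊥-elim (All.lookup x∉xs m refl)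
    ... | inj₂ (there m₂) = ∈.∈-++⁺ʳ ys₁ m₂
    insert : ∀ {z} → z ∈ ys₁ ++ ys₂ → z ∈ ys₁ ++ x ∷ ys₂
    insert m with ∈.∈-++⁻ ys₁ m
    ... | inj₁ m₁ = ∈.∈-++⁺ˡ m₁
    ... | inj₂ m₂ = ∈.∈-++⁺ʳ ys₁ (there m₂)
    from : ∀ {z} → z ∈ ys₁ ++ ys₂ → z ∈ xs
    from m with ys⊆ (insert m)
    ... | here refl = ⊥-elim (Unique-deleted-∉ ys₁ uys m)
    ... | there m' = m'

  sumRange : ℕ → ℕ → (ℕ → ℕ) → ℕ
  sumRange zero j F = 0
  sumRange (suc k) j F = F j + sumRange k (suc j) F

  sumRange-split : ∀ a b j F → sumRange (a + b) j F ≡ sumRange a j F + sumRange b (a + j) F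
  sumRange-split zero b j F = refl
  sumRange-split (suc a) b j F =
    trans (cong (F j +_) (trans (sumRange-split a b (suc j) F) (cong (λ i → sumRange a (suc j) F + sumRange b i F) (+-suc a j))))
          (sym (+-assoc (F j) _ _))

  sumRange-cong : ∀ k j {F G : ℕ → ℕ} → (∀ t → t < k → F (j + t) ≡ G (j + t)) → sumRange k j F ≡ sumRange k j G
  sumRange-cong zero j e = refl
  sumRange-cong (suc k) j {F} {G} e =
    cong₂ _+_ (subst (λ i → F i ≡ G i) (+-identityʳ j) (e 0 (s≤s z≤n)))
              (sumRange-cong k (suc j) λ t t<k → subst (λ i → F i ≡ G i) (+-suc j t) (e (suc t) (s≤s t<k)))

  sumRange-zero : ∀ k j F → (∀ t → j ≤ t → t < k + j → F t ≡ 0) → sumRange k j F ≡ 0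
  sumRange-zero zero j F h = refl
  sumRange-zero (suc k) j F h = cong₂ _+_ (h j ≤-refl (s≤s (m≤n+m j k)))
    (sumRange-zero k (suc j) F λ t j<t t<k+sj → h t (<⇒≤ j<t) (subst (t <_) (+-suc k j) t<k+sj))

  sumRange-last : ∀ k j F → sumRange (suc k) j F ≡ sumRange k j F + F (k + j)
  sumRange-last zero j F = +-comm (F j) 0
  sumRange-last (suc k) j F =
    trans (cong (F j +_) (trans (sumRange-last k (suc j) F) (cong (λ i → sumRange k (suc j) F + F i) (+-suc k j))))
          (sym (+-assoc (F j) _ _))

  sumRange-+ : ∀ k j F G → sumRange k j (λ t → F t + G t) ≡ sumRange k j F + sumRange k j G
  sumRange-+ zero j F G = refl
  sumRange-+ (suc k) j F G = trans (cong (F j + G j +_) (sumRange-+ k (suc j) F G)) (interchange (F j) (G j) _ _)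

  sumRange-*ʳ : ∀ k j F c → sumRange k j (λ t → F t * c) ≡ sumRange k j F * c
  sumRange-*ʳ zero j F c = refl
  sumRange-*ʳ (suc k) j F c = trans (cong (F j * c +_) (sumRange-*ʳ k (suc j) F c)) (sym (*-distribʳ-+ c (F j) _))

  sumRange-*ˡ : ∀ k j F c → sumRange k j (λ t → c * F t) ≡ c * sumRange k j F
  sumRange-*ˡ zero j F c = sym (*-zeroʳ c)
  sumRange-*ˡ (suc k) j F c = trans (cong (c * F j +_) (sumRange-*ˡ k (suc j) F c)) (sym (*-distribˡ-+ c (F j) _))

  sumRange-shift : ∀ k j F → sumRange k j F ≡ sumRange k 0 (λ t → F (j + t))
  sumRange-shift zero j F = refl
  sumRange-shift (suc k) j F = cong₂ _+_ (cong F (sym (+-identityʳ j)))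
    (trans (sumRange-shift k (suc j) F)
      (trans (sumRange-cong k 0 (λ t _ → cong F (sym (+-suc j t)))) (sym (sumRange-shift k 1 (λ t → F (j + t))))))

  sumL-sumRange : {A : Set} (xs : List A) (k j : ℕ) (G : ℕ → A → ℕ) →
    sumL xs (λ x → sumRange k j (λ t → G t x)) ≡ sumRange k j (λ t → sumL xs (G t))
  sumL-sumRange xs zero j G = sumL-zero xs
  sumL-sumRange xs (suc k) j G = trans (sumL-+ xs (G j) _) (cong (sumL xs (G j) +_) (sumL-sumRange xs k (suc j) G))

  -- Binomial coefficients, defined by Pascal's rule so that the rule holds by computation.
  binom : ℕ → ℕ → ℕ
  binom n zero = 1
  binom zero (suc k) = 0
  binom (suc n) (suc k) = binom n k + binom n (suc k)

  binom-> : ∀ n k → n < k → binom n k ≡ 0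
  binom-> zero (suc k) _ = refl
  binom-> (suc n) (suc k) (s≤s n<k) = cong₂ _+_ (binom-> n k n<k) (binom-> n (suc k) (<-trans n<k ≤-refl))

  binom-diag : ∀ n → binom n n ≡ 1
  binom-diag zero = refl
  binom-diag (suc n) = cong₂ _+_ (binom-diag n) (binom-> n (suc n) ≤-refl)

  binom-row-sum : ∀ n → sumRange (suc n) 0 (binom n) ≡ 2 ^ n
  binom-row-sum zero = refl
  binom-row-sum (suc n) = begin
      1 + sumRange (suc n) 1 (binom (suc n))
    ≡⟨ cong suc (sumRange-shift (suc n) 1 (binom (suc n))) ⟩
      1 + sumRange (suc n) 0 (λ t → binom n t + binom n (suc t))
    ≡⟨ cong suc (sumRange-+ (suc n) 0 (binom n) (λ t → binom n (suc t))) ⟩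
      1 + (T + sumRange (suc n) 0 (λ t → binom n (suc t)))
    ≡⟨ cong (λ q → 1 + (T + q)) (sym (sumRange-shift (suc n) 1 (binom n))) ⟩
      1 + (T + sumRange (suc n) 1 (binom n))
    ≡⟨ cong (λ q → 1 + (T + q)) (sumRange-last n 1 (binom n)) ⟩
      1 + (T + (sumRange n 1 (binom n) + binom n (n + 1)))
    ≡⟨ cong (λ q → 1 + (T + (sumRange n 1 (binom n) + q))) (binom-> n (n + 1) (subst (n <_) (+-comm 1 n) ≤-refl)) ⟩
      1 + (T + (sumRange n 1 (binom n) + 0))
    ≡⟨ rearrange T (sumRange n 1 (binom n)) ⟩
      T + (1 + sumRange n 1 (binom n))
    ≡⟨ cong₂ _+_ (binom-row-sum n) (binom-row-sum n) ⟩
      2 ^ n + 2 ^ n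
    ≡⟨ cong (2 ^ n +_) (sym (+-identityʳ (2 ^ n))) ⟩
      2 ^ suc n ∎
    where
    open ≡-Reasoning
    T = sumRange (suc n) 0 (binom n)
    rearrange : ∀ a b → 1 + (a + (b + 0)) ≡ a + (1 + b)
    rearrange = solve 2 (λ a b → con 1 :+ (a :+ (b :+ con 0)) := a :+ (con 1 :+ b)) refl

module Peaks where

  open import Defs
  open Sums
  open import Data.Nat as ℕ using (ℕ; zero; suc; _+_; _≤_; _<_; z≤n; s≤s)
  open import Data.Nat.Properties
  open import Data.Integer using (ℤ) renaming (_<_ to _<ᶻ_)
  import Data.Integer.Properties as ℤP
  open import Data.List using (List; []; _∷_; _++_; map; length)
  import Data.List.Properties as LP
  open import Data.List.Relation.Unary.All as All using (All; []; _∷_)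
  import Data.List.Relation.Unary.All.Properties as AllP
  open import Data.List.Relation.Unary.AllPairs using (AllPairs; []; _∷_)
  open import Data.Product using (_×_; _,_; proj₁; proj₂)
  open import Data.Sum using (_⊎_; inj₁; inj₂)
  open import Data.Empty using (⊥; ⊥-elim)
  open import Relation.Nullary using (Dec; yes; no; _×-dec_)
  open import Relation.Binary.PropositionalEquality


  _≟L_ : (x y : List ℕ) → Dec (x ≡ y)
  _≟L_ = LP.≡-dec ℕ._≟_

  peakHere-++ : ∀ i a rest acc → peakHere i a rest acc ≡ peakHere i a rest [] ++ acc
  peakHere-++ i a [] acc = refl
  peakHere-++ i a (b ∷ []) acc = refl
  peakHere-++ i a (b ∷ c ∷ r) acc with (a ℤP.<? b) ×-dec (c ℤP.<? b)
  ... | yes _ = refl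
  ... | no _ = refl

  peakHere-local : ∀ i a b c r r' acc → peakHere i a (b ∷ c ∷ r) acc ≡ peakHere i a (b ∷ c ∷ r') acc
  peakHere-local i a b c r r' acc with (a ℤP.<? b) ×-dec (c ℤP.<? b)
  ... | yes _ = refl
  ... | no _ = refl

  peakHere-suc : ∀ i a rest acc → peakHere (suc i) a rest (map suc acc) ≡ map suc (peakHere i a rest acc)
  peakHere-suc i a [] acc = refl
  peakHere-suc i a (b ∷ []) acc = refl
  peakHere-suc i a (b ∷ c ∷ r) acc with (a ℤP.<? b) ×-dec (c ℤP.<? b)
  ... | yes _ = refl
  ... | no _ = refl

  peaksFrom-suc : ∀ i w → peaksFrom (suc i) w ≡ map suc (peaksFrom i w)
  peaksFrom-suc i [] = refl
  peaksFrom-suc i (a ∷ w) = trans (cong (peakHere (suc i) a w) (peaksFrom-suc (suc i) w)) (peakHere-suc i a w _)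

  peaksFrom-offset : ∀ i w → peaksFrom i w ≡ map (i +_) (peaksFrom 0 w)
  peaksFrom-offset zero w = sym (LP.map-id (peaksFrom 0 w))
  peaksFrom-offset (suc i) w =
    trans (peaksFrom-suc i w) (trans (cong (map suc) (peaksFrom-offset i w)) (sym (LP.map-∘ (peaksFrom 0 w))))

  peakless-shift : ∀ i j w → peaksFrom i w ≡ [] → peaksFrom j w ≡ []
  peakless-shift i j w e = trans (peaksFrom-offset j w) (cong (map (j +_)) (map≡[] (trans (sym (peaksFrom-offset i w)) e)))
    where
    map≡[] : ∀ {xs : List ℕ} {f : ℕ → ℕ} → map f xs ≡ [] → xs ≡ []
    map≡[] {[]} _ = refl

  -- The peaks of αβ that sit on the seam, i.e. at the last two positions of α.
  seamPeaks : ℕ → List ℤ → List ℤ → List ℕ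
  seamPeaks i [] β = []
  seamPeaks i (x ∷ []) β = peakHere i x β []
  seamPeaks i (x ∷ y ∷ []) β = peakHere i x (y ∷ β) (peakHere (suc i) y β [])
  seamPeaks i (x ∷ y ∷ z ∷ α) β = seamPeaks (suc i) (y ∷ z ∷ α) β

  peaksFrom-++ : ∀ i α β → peaksFrom i (α ++ β) ≡ peaksFrom i α ++ seamPeaks i α β ++ peaksFrom (i + length α) β
  peaksFrom-++ i [] β = cong (λ k → peaksFrom k β) (sym (+-identityʳ i))
  peaksFrom-++ i (x ∷ []) β = trans (peakHere-++ i x β _) (cong (λ k → peakHere i x β [] ++ peaksFrom k β) (+-comm 1 i))
  peaksFrom-++ i (x ∷ y ∷ []) β = begin
      peakHere i x (y ∷ β) (peakHere (suc i) y β (peaksFrom (suc (suc i)) β))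
    ≡⟨ cong (peakHere i x (y ∷ β)) (peakHere-++ (suc i) y β _) ⟩
      peakHere i x (y ∷ β) (Y ++ Q)
    ≡⟨ peakHere-++ i x (y ∷ β) _ ⟩
      peakHere i x (y ∷ β) [] ++ Y ++ Q
    ≡⟨ sym (LP.++-assoc (peakHere i x (y ∷ β) []) Y Q) ⟩
      (peakHere i x (y ∷ β) [] ++ Y) ++ Q
    ≡⟨ cong₂ _++_ (sym (peakHere-++ i x (y ∷ β) Y)) (cong (λ k → peaksFrom k β) (+-comm 2 i)) ⟩
      seamPeaks i (x ∷ y ∷ []) β ++ peaksFrom (i + 2) β ∎
    where
    open ≡-Reasoning
    Y = peakHere (suc i) y β []
    Q = peaksFrom (suc (suc i)) β
  peaksFrom-++ i (x ∷ y ∷ z ∷ α) β = begin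
      peakHere i x (y ∷ z ∷ α ++ β) (peaksFrom (suc i) (y ∷ z ∷ α ++ β))
    ≡⟨ peakHere-local i x y z (α ++ β) α _ ⟩
      peakHere i x (y ∷ z ∷ α) (peaksFrom (suc i) (y ∷ z ∷ α ++ β))
    ≡⟨ cong (peakHere i x (y ∷ z ∷ α)) (peaksFrom-++ (suc i) (y ∷ z ∷ α) β) ⟩
      peakHere i x (y ∷ z ∷ α) (A ++ M ++ Q)
    ≡⟨ peakHere-++ i x (y ∷ z ∷ α) _ ⟩
      X ++ A ++ M ++ Q
    ≡⟨ sym (LP.++-assoc X A (M ++ Q)) ⟩
      (X ++ A) ++ M ++ Q
    ≡⟨ cong₂ (λ u k → u ++ M ++ peaksFrom k β) (sym (peakHere-++ i x (y ∷ z ∷ α) A)) (sym (+-suc i _)) ⟩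
      peaksFrom i (x ∷ y ∷ z ∷ α) ++ M ++ peaksFrom (i + length (x ∷ y ∷ z ∷ α)) β ∎
    where
    open ≡-Reasoning
    X = peakHere i x (y ∷ z ∷ α) []
    A = peaksFrom (suc i) (y ∷ z ∷ α)
    M = seamPeaks (suc i) (y ∷ z ∷ α) β
    Q = peaksFrom (suc i + length (y ∷ z ∷ α)) β

  PB-++ : ∀ α β → PB (α ++ β) ≡ PB α ++ seamPeaks 1 α β ++ peaksFrom (suc (length α)) β
  PB-++ α β = peaksFrom-++ 1 α β

  -- Order isomorphism.  SameRank x y u v: x compares with the letters of u
  -- exactly as y compares with the corresponding letters of v.
  data SameRank (x y : ℤ) : List ℤ → List ℤ → Set where
    [] : SameRank x y [] []
    _∷_ : ∀ {a b u v} → Iff (x <ᶻ a) (y <ᶻ b) × Iff (a <ᶻ x) (b <ᶻ y) → SameRank x y u v → SameRank x y (a ∷ u) (b ∷ v)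

  data OrderIso : List ℤ → List ℤ → Set where
    [] : OrderIso [] []
    _∷_ : ∀ {x y u v} → SameRank x y u v → OrderIso u v → OrderIso (x ∷ u) (y ∷ v)

  private
    peakHere-orderIso : ∀ i a a' b b' c c' r r' acc → Iff (a <ᶻ b) (a' <ᶻ b') → Iff (c <ᶻ b) (c' <ᶻ b') →
      peakHere i a (b ∷ c ∷ r) acc ≡ peakHere i a' (b' ∷ c' ∷ r') acc
    peakHere-orderIso i a a' b b' c c' r r' acc ab cb with (a ℤP.<? b) ×-dec (c ℤP.<? b) | (a' ℤP.<? b') ×-dec (c' ℤP.<? b')
    ... | yes _ | yes _ = refl
    ... | no _ | no _ = refl
    ... | yes (a<b , c<b) | no ¬peak = ⊥-elim (¬peak (proj₁ ab a<b , proj₁ cb c<b))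
    ... | no ¬peak | yes (a<b , c<b) = ⊥-elim (¬peak (proj₂ ab a<b , proj₂ cb c<b))

  peaksFrom-orderIso : ∀ i {u v} → OrderIso u v → peaksFrom i u ≡ peaksFrom i v
  peaksFrom-orderIso i [] = refl
  peaksFrom-orderIso i ([] ∷ []) = refl
  peaksFrom-orderIso i ((_ ∷ []) ∷ ([] ∷ [])) = refl
  peaksFrom-orderIso i (_∷_ {a} {a'} {b ∷ c ∷ r} {b' ∷ c' ∷ r'} ((ab , _) ∷ _) iso@(((_ , cb) ∷ _) ∷ _)) =
    trans (peakHere-orderIso i a a' b b' c c' r r' _ ab cb) (cong (peakHere i a' (b' ∷ c' ∷ r')) (peaksFrom-orderIso (suc i) iso))

  peakHere-All : ∀ {P : ℕ → Set} i a rest acc → All P acc →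
    (∀ b c r → rest ≡ b ∷ c ∷ r → P (suc i)) → All P (peakHere i a rest acc)
  peakHere-All i a [] acc pa h = pa
  peakHere-All i a (b ∷ []) acc pa h = pa
  peakHere-All i a (b ∷ c ∷ r) acc pa h with (a ℤP.<? b) ×-dec (c ℤP.<? b)
  ... | yes _ = h b c r refl ∷ pa
  ... | no _ = pa

  peaksFrom-bounds : ∀ i w → All (λ p → i < p × suc p < length w + i) (peaksFrom i w)
  peaksFrom-bounds i [] = []
  peaksFrom-bounds i (a ∷ rest) = peakHere-All i a rest _
    (All.map (λ {p} (i<p , p<) → <-trans ≤-refl i<p , subst (suc p <_) (+-suc (length rest) i) p<) (peaksFrom-bounds (suc i) rest))
    (λ { b c r refl → ≤-refl , s≤s (s≤s (s≤s (m≤n+m i (length r)))) })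

  PB-bounds : ∀ w → All (λ p → 2 ≤ p × suc p ≤ length w) (PB w)
  PB-bounds w = All.map (λ {p} (1<p , p<) → 1<p , ≤-pred (subst (suc p <_) (+-comm (length w) 1) p<)) (peaksFrom-bounds 1 w)

  length-peaksFrom : ∀ i w → length (peaksFrom i w) ≤ length w
  length-peaksFrom i [] = z≤n
  length-peaksFrom i (a ∷ rest) = subst (_≤ suc (length rest)) (sym (cong length (peakHere-++ i a rest _)))
    (subst (_≤ suc (length rest)) (sym (LP.length-++ (peakHere i a rest []))) (count rest (length-peaksFrom (suc i) rest)))
    where
    count : ∀ rest → length (peaksFrom (suc i) rest) ≤ length rest →
      length (peakHere i a rest []) + length (peaksFrom (suc i) rest) ≤ suc (length rest)
    count [] h = m≤n⇒m≤1+n h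
    count (b ∷ []) h = m≤n⇒m≤1+n h
    count (b ∷ c ∷ r) h with (a ℤP.<? b) ×-dec (c ℤP.<? b)
    ... | yes _ = s≤s h
    ... | no _ = m≤n⇒m≤1+n h

  Gap : ℕ → ℕ → Set
  Gap p q = suc p < q

  ValidPeakSet : List ℕ → Set
  ValidPeakSet S = All (2 ≤_) S × AllPairs Gap S

  private
    peakHere-descent : ∀ i a c r acc → c <ᶻ a → peakHere i a (c ∷ r) acc ≡ acc
    peakHere-descent i a c [] acc _ = refl
    peakHere-descent i a c (d ∷ r) acc c<a with (a ℤP.<? c) ×-dec (d ℤP.<? c)
    ... | yes (a<c , _) = ⊥-elim (ℤP.<-asym a<c c<a)
    ... | no _ = refl

    gapHere : ∀ i a rest acc → AllPairs Gap acc → (∀ b c r → rest ≡ b ∷ c ∷ r → c <ᶻ b → All (Gap (suc i)) acc) →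
      AllPairs Gap (peakHere i a rest acc)
    gapHere i a [] acc ap h = ap
    gapHere i a (b ∷ []) acc ap h = ap
    gapHere i a (b ∷ c ∷ r) acc ap h with (a ℤP.<? b) ×-dec (c ℤP.<? b)
    ... | yes (_ , c<b) = h b c r refl c<b ∷ ap
    ... | no _ = ap

    peaksFrom-gaps : ∀ i w → AllPairs Gap (peaksFrom i w)
    peaksFrom-gaps i [] = []
    peaksFrom-gaps i (a ∷ rest) = gapHere i a rest _ (peaksFrom-gaps (suc i) rest)
      λ { b c r refl c<b → subst (All (Gap (suc i))) (sym (peakHere-descent (suc i) b c r _ c<b))
            (All.map proj₁ (peaksFrom-bounds (suc (suc i)) (c ∷ r))) }

  PB-valid : ∀ w → ValidPeakSet (PB w)
  PB-valid w = All.map proj₁ (PB-bounds w) , peaksFrom-gaps 1 w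

  data SeamPeak (a : ℕ) : List ℕ → Set where
    none : SeamPeak a []
    at : SeamPeak a (a ∷ [])
    after : SeamPeak a (suc a ∷ [])

  private
    seamPeaks-from : ∀ i α β → 1 ≤ length α →
      (seamPeaks i α β ≡ []) ⊎ (seamPeaks i α β ≡ ℕ.pred (length α + i) ∷ []) ⊎ (seamPeaks i α β ≡ (length α + i) ∷ [])
    seamPeaks-from i (x ∷ []) [] _ = inj₁ refl
    seamPeaks-from i (x ∷ []) (b ∷ []) _ = inj₁ refl
    seamPeaks-from i (x ∷ []) (b ∷ c ∷ r) _ with (x ℤP.<? b) ×-dec (c ℤP.<? b)
    ... | yes _ = inj₂ (inj₂ refl)
    ... | no _ = inj₁ refl
    seamPeaks-from i (x ∷ y ∷ []) [] _ = inj₁ refl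
    seamPeaks-from i (x ∷ y ∷ []) (b ∷ []) _ with (x ℤP.<? y) ×-dec (b ℤP.<? y)
    ... | yes _ = inj₂ (inj₁ refl)
    ... | no _ = inj₁ refl
    seamPeaks-from i (x ∷ y ∷ []) (b ∷ c ∷ r) _ with (x ℤP.<? y) ×-dec (b ℤP.<? y) | (y ℤP.<? b) ×-dec (c ℤP.<? b)
    ... | yes _ | no _ = inj₂ (inj₁ refl)
    ... | no _ | yes _ = inj₂ (inj₂ refl)
    ... | no _ | no _ = inj₁ refl
    ... | yes (_ , b<y) | yes (y<b , _) = ⊥-elim (ℤP.<-asym b<y y<b)
    seamPeaks-from i (x ∷ y ∷ z ∷ α) β _ =
      subst (λ k → (M ≡ []) ⊎ (M ≡ ℕ.pred k ∷ []) ⊎ (M ≡ k ∷ []))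
        (+-suc (length (y ∷ z ∷ α)) i) (seamPeaks-from (suc i) (y ∷ z ∷ α) β (s≤s z≤n))
      where M = seamPeaks (suc i) (y ∷ z ∷ α) β

  seamPeak : ∀ α β → 1 ≤ length α → SeamPeak (length α) (seamPeaks 1 α β)
  seamPeak α β h with subst (λ k → (M ≡ []) ⊎ (M ≡ ℕ.pred k ∷ []) ⊎ (M ≡ k ∷ [])) (+-comm (length α) 1) (seamPeaks-from 1 α β h)
    where M = seamPeaks 1 α β
  ... | inj₁ e = subst (SeamPeak _) (sym e) none
  ... | inj₂ (inj₁ e) = subst (SeamPeak _) (sym e) at
  ... | inj₂ (inj₂ e) = subst (SeamPeak _) (sym e) after

  private
    seam-lower : ∀ {a X} → SeamPeak a X → All (a ≤_) X
    seam-lower none = []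
    seam-lower at = ≤-refl ∷ []
    seam-lower after = n≤1+n _ ∷ []

    seam-upper : ∀ {a X} → SeamPeak a X → All (_≤ suc a) X
    seam-upper none = []
    seam-upper at = n≤1+n _ ∷ []
    seam-upper after = ≤-refl ∷ []

    ++-split-at : ∀ a {A B C D : List ℕ} → A ++ B ≡ C ++ D → All (_< a) A → All (_< a) C →
      All (a ≤_) B → All (a ≤_) D → A ≡ C × B ≡ D
    ++-split-at a {[]} {B} {[]} e _ _ _ _ = refl , e
    ++-split-at a {[]} {B} {c ∷ C} refl _ (c<a ∷ _) (a≤c ∷ _) _ = ⊥-elim (<-irrefl refl (<-≤-trans c<a a≤c))
    ++-split-at a {x ∷ A} {B} {[]} refl (x<a ∷ _) _ _ (a≤x ∷ _) = ⊥-elim (<-irrefl refl (<-≤-trans x<a a≤x))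
    ++-split-at a {x ∷ A} {B} {c ∷ C} e (_ ∷ pA) (_ ∷ pC) pB pD with LP.∷-injective e
    ... | refl , e' with ++-split-at a {A} {B} {C} e' pA pC pB pD
    ... | refl , e'' = refl , e''

    T++X≢T++Y : ∀ (T : List ℕ) {X Y : List ℕ} → X ≢ Y → T ++ X ≢ T ++ Y
    T++X≢T++Y T X≢Y e = X≢Y (LP.++-cancelˡ T _ _ e)

    seam-indicators : ∀ T a {X} → SeamPeak a X → (L : List ℕ) → L ≡ T ++ X →
      𝟙 (L ≟L T) + 𝟙 (L ≟L (T ++ a ∷ [])) + 𝟙 (L ≟L (T ++ suc a ∷ [])) ≡ 1
    seam-indicators T a none L refl rewrite LP.++-identityʳ T =
      cong₂ _+_ (cong₂ _+_ (𝟙-yes (T ≟L T) refl) (𝟙-no (T ≟L _) (T≢ (λ ()))))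
                (𝟙-no (T ≟L _) (T≢ (λ ())))
      where T≢ = λ {X} (ne : [] ≢ X) e → T++X≢T++Y T ne (trans (LP.++-identityʳ T) e)
    seam-indicators T a at L refl =
      cong₂ _+_ (cong₂ _+_ (𝟙-no (_ ≟L T) λ e → T++X≢T++Y T (λ ()) (trans (LP.++-identityʳ T) (sym e))) (𝟙-yes (_ ≟L _) refl))
                (𝟙-no (_ ≟L _) (T++X≢T++Y T λ e → <-irrefl (proj₁ (LP.∷-injective e)) ≤-refl))
    seam-indicators T a after L refl =
      cong₂ _+_ (cong₂ _+_ (𝟙-no (_ ≟L T) λ e → T++X≢T++Y T (λ ()) (trans (LP.++-identityʳ T) (sym e)))
                           (𝟙-no (_ ≟L _) (T++X≢T++Y T λ e → <-irrefl (sym (proj₁ (LP.∷-injective e))) ≤-refl)))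
                (𝟙-yes (_ ≟L _) refl)

  -- The peak-splitting identity: for |α| = a ≥ 1 and T ⊆ [1, a),
  --   [P(α) = T]·[P(β) = ∅] = [P(αβ) = T] + [P(αβ) = T∪{a}] + [P(αβ) = T∪{a+1}].
  -- Indeed P(αβ) = P(α) ∪ (seam peak) ∪ (peaks of β shifted by a), and the
  -- pieces are separated by the thresholds a and a+1.
  peak-split : ∀ α β T → 1 ≤ length α → All (_< length α) T →
    𝟙 (PB α ≟L T) ℕ.* 𝟙 (PB β ≟L []) ≡
    𝟙 (PB (α ++ β) ≟L T) + 𝟙 (PB (α ++ β) ≟L (T ++ length α ∷ [])) + 𝟙 (PB (α ++ β) ≟L (T ++ suc (length α) ∷ []))
  peak-split α β T 1≤a T<a = cases (PB α ≟L T) (PB β ≟L [])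
    where
    a = length α
    Q = peaksFrom (suc a) β
    seam : SeamPeak a (seamPeaks 1 α β)
    seam = seamPeak α β 1≤a
    α-below : All (_< a) (PB α)
    α-below = All.map (λ {p} (_ , p<) → ≤-pred (subst (suc p <_) (+-comm a 1) p<)) (peaksFrom-bounds 1 α)
    β-above : All (suc a <_) Q
    β-above = All.map proj₁ (peaksFrom-bounds (suc a) β)
    rest-above : All (a ≤_) (seamPeaks 1 α β ++ Q)
    rest-above = AllP.++⁺ (seam-lower seam) (All.map (λ x → <⇒≤ (<-trans ≤-refl x)) β-above)
    recover : ∀ {X} → SeamPeak a X → PB (α ++ β) ≡ T ++ X → PB α ≡ T × PB β ≡ []
    recover sX e with ++-split-at a (trans (sym (PB-++ α β)) e) α-below T<a rest-above (seam-lower sX)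
    ... | αT , rest≡X = αT , peakless-shift (suc a) 1 β
        (Q-empty (AllP.++⁻ʳ (seamPeaks 1 α β) (subst (All (_≤ suc a)) (sym rest≡X) (seam-upper sX))) β-above)
      where
      Q-empty : ∀ {L} → All (_≤ suc a) L → All (suc a <_) L → L ≡ []
      Q-empty [] _ = refl
      Q-empty (x ∷ _) (y ∷ _) = ⊥-elim (<-irrefl refl (<-≤-trans y x))
    none-match : (∀ {X} → SeamPeak a X → PB (α ++ β) ≡ T ++ X → ⊥) →
       𝟙 (PB (α ++ β) ≟L T) + 𝟙 (PB (α ++ β) ≟L (T ++ a ∷ [])) + 𝟙 (PB (α ++ β) ≟L (T ++ suc a ∷ [])) ≡ 0
    none-match k =
      cong₂ _+_ (cong₂ _+_ (𝟙-no (PB (α ++ β) ≟L T) (λ e → k none (trans e (sym (LP.++-identityʳ T)))))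
                           (𝟙-no (PB (α ++ β) ≟L _) (k at)))
                (𝟙-no (PB (α ++ β) ≟L _) (k after))
    cases : (d₁ : Dec (PB α ≡ T)) (d₂ : Dec (PB β ≡ [])) → 𝟙 d₁ ℕ.* 𝟙 d₂ ≡
       𝟙 (PB (α ++ β) ≟L T) + 𝟙 (PB (α ++ β) ≟L (T ++ a ∷ [])) + 𝟙 (PB (α ++ β) ≟L (T ++ suc a ∷ []))
    cases (yes αT) (yes β∅) = sym (seam-indicators T a seam (PB (α ++ β))
       (trans (PB-++ α β) (cong₂ _++_ αT (trans (cong (seamPeaks 1 α β ++_) (peakless-shift 1 (suc a) β β∅))
                                                  (LP.++-identityʳ _)))))
    cases (yes _) (no ¬β∅) = sym (none-match λ sX e → ¬β∅ (proj₂ (recover sX e)))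
    cases (no ¬αT) _ = sym (none-match λ sX e → ¬αT (proj₁ (recover sX e)))

module Insertion where

  open Sums
  open Peaks using (SameRank; OrderIso; []; _∷_)
  open import Data.Nat using (ℕ; zero; suc; _+_; _≤_; _<_; s≤s)
  open import Data.Nat.Properties
  open import Data.Integer using (ℤ; +_; -[1+_]; ∣_∣; +<+; -<+; -<-) renaming (_<_ to _<ᶻ_)
  import Data.Integer.Properties as ℤP
  open import Data.List using (List; []; _∷_; _++_; length)
  open import Data.List.Relation.Unary.All as All using (All; []; _∷_)
  import Data.List.Relation.Unary.All.Properties as AllP
  open import Data.Product using (_×_; _,_; proj₁; proj₂)
  open import Data.Sum using (_⊎_; inj₁; inj₂)
  open import Relation.Binary.PropositionalEquality

  -- insertAt t x w inserts the letter x before position t of w (at the end if t ≥ |w|).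
  insertAt : ℕ → ℤ → List ℤ → List ℤ
  insertAt zero x w = x ∷ w
  insertAt (suc t) x [] = x ∷ []
  insertAt (suc t) x (y ∷ w) = y ∷ insertAt t x w

  length-insertAt : ∀ t x w → length (insertAt t x w) ≡ suc (length w)
  length-insertAt zero x w = refl
  length-insertAt (suc t) x [] = refl
  length-insertAt (suc t) x (y ∷ w) = cong suc (length-insertAt t x w)

  All-insertAt : ∀ {P : ℤ → Set} t x w → P x → All P w → All P (insertAt t x w)
  All-insertAt zero x w p ps = p ∷ ps
  All-insertAt (suc t) x [] p ps = p ∷ []
  All-insertAt (suc t) x (y ∷ w) p (q ∷ ps) = q ∷ All-insertAt t x w p ps

  insertions : ℕ → ℕ → ℤ → ℤ → List ℤ → List (List ℤ)
  insertions zero j p m w = []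
  insertions (suc k) j p m w = insertAt j p w ∷ insertAt j m w ∷ insertions k (suc j) p m w

  extendAll : ℕ → List (List ℤ) → List (List ℤ)
  extendAll n [] = []
  extendAll n (w ∷ ws) = insertions (suc n) 0 (+ suc n) (-[1+ n ]) w ++ extendAll n ws

  -- Bᴵ n enumerates the signed permutations of length n by successive insertion
  -- of ±1, ±2, ..., ±n; it is the convenient form of B n for inductive counting.
  Bᴵ : ℕ → List (List ℤ)
  Bᴵ zero = [] ∷ []
  Bᴵ (suc n) = extendAll n (Bᴵ n)

  bothSigns : ℕ → (List ℤ → ℕ) → List ℤ → ℕ → ℕ
  bothSigns n f w t = f (insertAt t (+ suc n) w) + f (insertAt t (-[1+ n ]) w)

  sumL-insertions : ∀ k j p m w f →
    sumL (insertions k j p m w) f ≡ sumRange k j (λ t → f (insertAt t p w) + f (insertAt t m w))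
  sumL-insertions zero j p m w f = refl
  sumL-insertions (suc k) j p m w f =
    trans (cong (λ q → f (insertAt j p w) + (f (insertAt j m w) + q)) (sumL-insertions k (suc j) p m w f))
          (sym (+-assoc (f (insertAt j p w)) _ _))

  sumL-Bᴵ-suc : ∀ n f → sumL (Bᴵ (suc n)) f ≡ sumL (Bᴵ n) (λ w → sumRange (suc n) 0 (bothSigns n f w))
  sumL-Bᴵ-suc n f = go (Bᴵ n)
    where
    go : ∀ ws → sumL (extendAll n ws) f ≡ sumL ws (λ w → sumRange (suc n) 0 (bothSigns n f w))
    go [] = refl
    go (w ∷ ws) = trans (sumL-++ (insertions (suc n) 0 (+ suc n) (-[1+ n ]) w) (extendAll n ws) f)
      (cong₂ _+_ (sumL-insertions (suc n) 0 (+ suc n) (-[1+ n ]) w f) (go ws))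

  All-insertions : ∀ {P : List ℤ → Set} k j p m w → (∀ t → P (insertAt t p w) × P (insertAt t m w)) →
    All P (insertions k j p m w)
  All-insertions zero j p m w h = []
  All-insertions (suc k) j p m w h = proj₁ (h j) ∷ proj₂ (h j) ∷ All-insertions k (suc j) p m w h

  All-extendAll : ∀ {P Q : List ℤ → Set} n ws →
    (∀ w → P w → ∀ t → Q (insertAt t (+ suc n) w) × Q (insertAt t (-[1+ n ]) w)) → All P ws → All Q (extendAll n ws)
  All-extendAll n [] h [] = []
  All-extendAll n (w ∷ ws) h (pw ∷ pws) = AllP.++⁺ (All-insertions (suc n) 0 _ _ w (h w pw)) (All-extendAll n ws h pws)

  Bᴵ-length : ∀ n → All (λ w → length w ≡ n) (Bᴵ n)
  Bᴵ-length zero = refl ∷ []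
  Bᴵ-length (suc n) = All-extendAll n (Bᴵ n)
    (λ w e t → trans (length-insertAt t _ w) (cong suc e) , trans (length-insertAt t _ w) (cong suc e)) (Bᴵ-length n)

  Bounded : ℕ → List ℤ → Set
  Bounded b u = All (λ x → ∣ x ∣ < b) u

  Bounded-mono : ∀ {b c} → b ≤ c → ∀ {u} → Bounded b u → Bounded c u
  Bounded-mono b≤c = All.map (λ h → <-≤-trans h b≤c)

  Bᴵ-bounded : ∀ n → All (Bounded (suc n)) (Bᴵ n)
  Bᴵ-bounded zero = [] ∷ []
  Bᴵ-bounded (suc n) = All-extendAll n (Bᴵ n) (λ w bw t → extend w bw t refl , extend w bw t refl) (Bᴵ-bounded n)
    where
    extend : ∀ w → Bounded (suc n) w → ∀ t {x} → ∣ x ∣ ≡ suc n → Bounded (suc (suc n)) (insertAt t x w)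
    extend w bw t e = All-insertAt t _ w (s≤s (≤-reflexive e)) (Bounded-mono (n≤1+n _) bw)

  below-top : ∀ {k u} → Bounded (suc k) u → All (_<ᶻ + suc k) u
  below-top = All.map (λ {x} → lemma x)
    where
    lemma : ∀ {k} x → ∣ x ∣ < suc k → x <ᶻ + suc k
    lemma (+ m) h = +<+ h
    lemma -[1+ m ] h = -<+

  above-bottom : ∀ {k u} → Bounded (suc k) u → All (-[1+ k ] <ᶻ_) u
  above-bottom = All.map (λ {x} → lemma x)
    where
    lemma : ∀ {k} x → ∣ x ∣ < suc k → -[1+ k ] <ᶻ x
    lemma (+ m) h = -<+
    lemma -[1+ m ] (s≤s h) = -<- h

  Extremal : ℤ → ℤ → List ℤ → List ℤ → Set
  Extremal X Y u v = (All (_<ᶻ X) u × All (_<ᶻ Y) v) ⊎ (All (X <ᶻ_) u × All (Y <ᶻ_) v)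

  private
    sameRank-extremal : ∀ {X Y u v} → OrderIso u v → Extremal X Y u v → SameRank X Y u v
    sameRank-extremal [] _ = []
    sameRank-extremal (_ ∷ iso) (inj₁ (a<X ∷ au , b<Y ∷ bv)) =
      (Iff-ff (ℤP.<-asym a<X) (ℤP.<-asym b<Y) , Iff-tt a<X b<Y) ∷ sameRank-extremal iso (inj₁ (au , bv))
    sameRank-extremal (_ ∷ iso) (inj₂ (X<a ∷ au , Y<b ∷ bv)) =
      (Iff-tt X<a Y<b , Iff-ff (ℤP.<-asym X<a) (ℤP.<-asym Y<b)) ∷ sameRank-extremal iso (inj₂ (au , bv))

    sameRank-insertAt : ∀ {x y u v} j X Y → SameRank x y u v → Iff (x <ᶻ X) (y <ᶻ Y) × Iff (X <ᶻ x) (Y <ᶻ y) →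
      SameRank x y (insertAt j X u) (insertAt j Y v)
    sameRank-insertAt zero X Y c p = p ∷ c
    sameRank-insertAt (suc j) X Y [] p = p ∷ []
    sameRank-insertAt (suc j) X Y (q ∷ c) p = q ∷ sameRank-insertAt j X Y c p

  orderIso-insertAt : ∀ {u v} j X Y → OrderIso u v → Extremal X Y u v → OrderIso (insertAt j X u) (insertAt j Y v)
  orderIso-insertAt zero X Y iso e = sameRank-extremal iso e ∷ iso
  orderIso-insertAt (suc j) X Y [] e = [] ∷ []
  orderIso-insertAt (suc j) X Y (c ∷ iso) (inj₁ (a<X ∷ au , b<Y ∷ bv)) =
    sameRank-insertAt j X Y c (Iff-tt a<X b<Y , Iff-ff (ℤP.<-asym a<X) (ℤP.<-asym b<Y)) ∷ orderIso-insertAt j X Y iso (inj₁ (au , bv))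
  orderIso-insertAt (suc j) X Y (c ∷ iso) (inj₂ (X<a ∷ au , Y<b ∷ bv)) =
    sameRank-insertAt j X Y c (Iff-ff (ℤP.<-asym X<a) (ℤP.<-asym Y<b) , Iff-tt X<a Y<b) ∷ orderIso-insertAt j X Y iso (inj₂ (au , bv))

  orderIso-refl : ∀ u → OrderIso u u
  orderIso-refl [] = []
  orderIso-refl (x ∷ u) = sameRank-refl u ∷ orderIso-refl u
    where
    sameRank-refl : ∀ u → SameRank x x u u
    sameRank-refl [] = []
    sameRank-refl (a ∷ u) = (Iff-refl , Iff-refl) ∷ sameRank-refl u

  orderIso-length : ∀ {u v} → OrderIso u v → length u ≡ length v
  orderIso-length [] = refl
  orderIso-length (_ ∷ iso) = cong suc (orderIso-length iso)

  OrderInvariant : ℕ → (List ℤ → ℕ) → Set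
  OrderInvariant b f = ∀ {u v} → Bounded b u → Bounded b v → OrderIso u v → f u ≡ f v

  OrderInvariant-mono : ∀ {b c} → b ≤ c → ∀ {f} → OrderInvariant c f → OrderInvariant b f
  OrderInvariant-mono b≤c inv bu bv iso = inv (Bounded-mono b≤c bu) (Bounded-mono b≤c bv) iso

  bothSigns-invariant : ∀ {b f} → OrderInvariant b f → ∀ {k k'} u t → Bounded (suc k) u → Bounded (suc k') u →
    suc k < b → suc k' < b → bothSigns k f u t ≡ bothSigns k' f u t
  bothSigns-invariant inv u t bu bu' k<b k'<b =
    cong₂ _+_ (inv (bnd bu k<b refl) (bnd bu' k'<b refl) (orderIso-insertAt t _ _ (orderIso-refl u) (inj₁ (below-top bu , below-top bu'))))
              (inv (bnd bu k<b refl) (bnd bu' k'<b refl) (orderIso-insertAt t _ _ (orderIso-refl u) (inj₂ (above-bottom bu , above-bottom bu'))))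
    where
    bnd : ∀ {k b x} → Bounded (suc k) u → suc k < b → ∣ x ∣ ≡ suc k → Bounded b (insertAt t x u)
    bnd bu k<b e = All-insertAt t _ u (subst (_< _) (sym e) k<b) (Bounded-mono (<⇒≤ k<b) bu)

module Splitting where

  open Sums
  open Insertion
  open import Data.Nat using (ℕ; zero; suc; _+_; _*_; _∸_; _≤_; _<_; s≤s)
  open import Data.Nat.Properties
  open import Data.Integer using (ℤ; +_; -[1+_]; ∣_∣)
  open import Data.List using (List; []; _∷_; length; take; drop)
  import Data.List.Properties as LP
  open import Data.List.Relation.Unary.All as All using (All; []; _∷_)
  open import Data.Product using (_,_)
  open import Data.Sum using (inj₁; inj₂)
  open import Relation.Binary.PropositionalEquality

  take-insertAt-before : ∀ t a X u → t ≤ a → take (suc a) (insertAt t X u) ≡ insertAt t X (take a u)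
  take-insertAt-before zero a X u _ = refl
  take-insertAt-before (suc t) (suc a) X [] _ = refl
  take-insertAt-before (suc t) (suc a) X (y ∷ u) (s≤s t≤a) = cong (y ∷_) (take-insertAt-before t a X u t≤a)

  drop-insertAt-before : ∀ t a X u → t ≤ a → drop (suc a) (insertAt t X u) ≡ drop a u
  drop-insertAt-before zero a X u _ = refl
  drop-insertAt-before (suc t) (suc a) X [] _ = refl
  drop-insertAt-before (suc t) (suc a) X (y ∷ u) (s≤s t≤a) = drop-insertAt-before t a X u t≤a

  take-insertAt-after : ∀ a t X u → a ≤ length u → take a (insertAt (a + t) X u) ≡ take a u
  take-insertAt-after zero t X u _ = refl
  take-insertAt-after (suc a) t X (y ∷ u) (s≤s a≤) = cong (y ∷_) (take-insertAt-after a t X u a≤)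

  drop-insertAt-after : ∀ a t X u → a ≤ length u → drop a (insertAt (a + t) X u) ≡ insertAt t X (drop a u)
  drop-insertAt-after zero t X u _ = refl
  drop-insertAt-after (suc a) t X (y ∷ u) (s≤s a≤) = drop-insertAt-after a t X u a≤

  extendSum : ℕ → (List ℤ → ℕ) → List ℤ → ℕ
  extendSum n f u = sumRange (suc (length u)) 0 (bothSigns n f u)

  extendSum-invariant : ∀ n f → OrderInvariant (suc (suc n)) f → OrderInvariant (suc n) (extendSum n f)
  extendSum-invariant n f inv {u} {v} bu bv iso =
    trans (cong (λ k → sumRange (suc k) 0 (bothSigns n f u)) (orderIso-length iso))
      (sumRange-cong (suc (length v)) 0 λ t _ → cong₂ _+_ (inv (bnd bu refl) (bnd bv refl) (orderIso-insertAt t _ _ iso (inj₁ (below-top bu , below-top bv))))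
                                                            (inv (bnd bu refl) (bnd bv refl) (orderIso-insertAt t _ _ iso (inj₂ (above-bottom bu , above-bottom bv)))))
    where
    bnd : ∀ {t w x} → Bounded (suc n) w → ∣ x ∣ ≡ suc n → Bounded (suc (suc n)) (insertAt t x w)
    bnd {t} {w} bw e = All-insertAt t _ w (s≤s (≤-reflexive e)) (Bounded-mono (n≤1+n _) bw)

  -- Summing extendSum over B_c gives the sum over B_{c+1}: which extremal value
  -- is inserted is irrelevant to an order-invariant function.
  sumL-extendSum : ∀ {b} c n h → OrderInvariant b h → suc n < b → suc c < b → c ≤ n →
    sumL (Bᴵ c) (extendSum n h) ≡ sumL (Bᴵ (suc c)) h
  sumL-extendSum c n h inv n<b c<b c≤n = trans
    (sumL-cong (Bᴵ c) (All.zipWith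
      (λ {u} (lu , bu) → trans (cong (λ k → sumRange (suc k) 0 (bothSigns n h u)) lu)
        (sumRange-cong (suc c) 0 λ t _ → bothSigns-invariant inv u t (Bounded-mono (s≤s c≤n) bu) bu n<b c<b))
      (Bᴵ-length c , Bᴵ-bounded c)))
    (sym (sumL-Bᴵ-suc c h))

  splitSum : ℕ → ℕ → (List ℤ → ℕ) → (List ℤ → ℕ) → ℕ
  splitSum n a f g = sumL (Bᴵ n) (λ w → f (take a w) * g (drop a w))

  private
    splitSum-none : ∀ n f g → splitSum n 0 f g ≡ binom n 0 * (sumL (Bᴵ 0) f * sumL (Bᴵ n) g)
    splitSum-none n f g = trans (sumL-*ˡ (Bᴵ n) g (f [])) (sym (trans (*-identityˡ _) (cong (_* sumL (Bᴵ n) g) (+-identityʳ (f [])))))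

    splitSum-all : ∀ n f g → splitSum n n f g ≡ binom n n * (sumL (Bᴵ n) f * sumL (Bᴵ (n ∸ n)) g)
    splitSum-all n f g = begin
        sumL (Bᴵ n) (λ w → f (take n w) * g (drop n w))
      ≡⟨ sumL-cong (Bᴵ n) (All.map (λ {w} e → cong₂ _*_ (cong f (LP.take-all n w (≤-reflexive e)))
                                                          (cong g (LP.drop-all n w (≤-reflexive e)))) (Bᴵ-length n)) ⟩
        sumL (Bᴵ n) (λ w → f w * g [])
      ≡⟨ sumL-*ʳ (Bᴵ n) f (g []) ⟩
        sumL (Bᴵ n) f * g []
      ≡⟨ sym (trans (cong₂ (λ c k → c * (sumL (Bᴵ n) f * sumL (Bᴵ k) g)) (binom-diag n) (n∸n≡0 n))
                    (trans (*-identityˡ _) (cong (sumL (Bᴵ n) f *_) (+-identityʳ (g []))))) ⟩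
        binom n n * (sumL (Bᴵ n) f * sumL (Bᴵ (n ∸ n)) g) ∎
      where open ≡-Reasoning

    -- For a word u of length n and a = a'+1 ≤ n, the insertions of ±(n+1) into u
    -- fall either into the prefix (t < a) or into the suffix (t ≥ a).
    insertions-split : ∀ n a' f g u → length u ≡ n → suc a' ≤ n →
      sumRange (suc n) 0 (bothSigns n (λ w → f (take (suc a') w) * g (drop (suc a') w)) u) ≡
      extendSum n f (take a' u) * g (drop a' u) + f (take (suc a') u) * extendSum n g (drop (suc a') u)
    insertions-split n a' f g u lu a≤n = begin
        sumRange (suc n) 0 H
      ≡⟨ cong (λ k → sumRange k 0 H) (sym a+b) ⟩
        sumRange (a + b) 0 H
      ≡⟨ sumRange-split a b 0 H ⟩
        sumRange a 0 H + sumRange b (a + 0) H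
      ≡⟨ cong₂ _+_ prefix suffix ⟩
        extendSum n f (take a' u) * g (drop a' u) + f (take a u) * extendSum n g (drop a u) ∎
      where
      open ≡-Reasoning
      a = suc a'
      b = n ∸ a'
      H = bothSigns n (λ w → f (take a w) * g (drop a w)) u
      a+b : a + b ≡ suc n
      a+b = cong suc (m+[n∸m]≡n (<⇒≤ a≤n))
      a≤u : a ≤ length u
      a≤u = subst (a ≤_) (sym lu) a≤n
      |take| : suc (length (take a' u)) ≡ a
      |take| = cong suc (trans (LP.length-take a' u) (m≤n⇒m⊓n≡m (<⇒≤ a≤u)))
      |drop| : suc (length (drop a u)) ≡ b
      |drop| = trans (cong suc (trans (LP.length-drop a u) (cong (_∸ a) lu))) (sym (+-∸-assoc 1 a≤n))
      prefix : sumRange a 0 H ≡ extendSum n f (take a' u) * g (drop a' u)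
      prefix = begin
          sumRange a 0 H
        ≡⟨ sumRange-cong a 0 (λ t t<a → let t≤a' = ≤-pred t<a in
             trans (cong₂ _+_ (cong₂ _*_ (cong f (take-insertAt-before t a' _ u t≤a')) (cong g (drop-insertAt-before t a' _ u t≤a')))
                              (cong₂ _*_ (cong f (take-insertAt-before t a' _ u t≤a')) (cong g (drop-insertAt-before t a' _ u t≤a'))))
                   (sym (*-distribʳ-+ (g (drop a' u)) (f (insertAt t (+ suc n) (take a' u))) (f (insertAt t -[1+ n ] (take a' u)))))) ⟩
          sumRange a 0 (λ t → bothSigns n f (take a' u) t * g (drop a' u))
        ≡⟨ sumRange-*ʳ a 0 (bothSigns n f (take a' u)) (g (drop a' u)) ⟩
          sumRange a 0 (bothSigns n f (take a' u)) * g (drop a' u)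
        ≡⟨ cong (λ k → sumRange k 0 (bothSigns n f (take a' u)) * g (drop a' u)) (sym |take|) ⟩
          extendSum n f (take a' u) * g (drop a' u) ∎
      suffix : sumRange b (a + 0) H ≡ f (take a u) * extendSum n g (drop a u)
      suffix = begin
          sumRange b (a + 0) H
        ≡⟨ sumRange-shift b (a + 0) H ⟩
          sumRange b 0 (λ t → H (a + 0 + t))
        ≡⟨ sumRange-cong b 0 (λ t _ →
             trans (cong₂ _+_ (cong₂ _*_ (cong f (tk t _)) (cong g (dr t _))) (cong₂ _*_ (cong f (tk t _)) (cong g (dr t _))))
                   (sym (*-distribˡ-+ (f (take a u)) (g (insertAt t (+ suc n) (drop a u))) (g (insertAt t -[1+ n ] (drop a u)))))) ⟩
          sumRange b 0 (λ t → f (take a u) * bothSigns n g (drop a u) t)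
        ≡⟨ sumRange-*ˡ b 0 (bothSigns n g (drop a u)) (f (take a u)) ⟩
          f (take a u) * sumRange b 0 (bothSigns n g (drop a u))
        ≡⟨ cong (λ k → f (take a u) * sumRange k 0 (bothSigns n g (drop a u))) (sym |drop|) ⟩
          f (take a u) * extendSum n g (drop a u) ∎
        where
        tk : ∀ t X → take a (insertAt (a + 0 + t) X u) ≡ take a u
        tk t X = subst (λ k → take a (insertAt (k + t) X u) ≡ take a u) (sym (+-identityʳ a)) (take-insertAt-after a t X u a≤u)
        dr : ∀ t X → drop a (insertAt (a + 0 + t) X u) ≡ insertAt t X (drop a u)
        dr t X = subst (λ k → drop a (insertAt (k + t) X u) ≡ insertAt t X (drop a u)) (sym (+-identityʳ a)) (drop-insertAt-after a t X u a≤u)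

  -- The splitting theorem: for order-invariant f and g and a ≤ n,
  --   Σ_{w ∈ B_n} f(w₁…w_a)·g(w_{a+1}…w_n) = C(n,a) · Σ_{B_a} f · Σ_{B_{n-a}} g,
  -- since a signed permutation is a choice of which a absolute values go to the
  -- prefix, together with the two standardised halves.  Proof by induction on n,
  -- classifying where ±n was inserted.
  splitting : ∀ n a → a ≤ n → ∀ f g → OrderInvariant (suc n) f → OrderInvariant (suc n) g →
    splitSum n a f g ≡ binom n a * (sumL (Bᴵ a) f * sumL (Bᴵ (n ∸ a)) g)
  splitting n zero _ f g _ _ = splitSum-none n f g
  splitting n (suc a') a≤n f g invf invg with m≤n⇒m<n∨m≡n a≤n
  ... | inj₂ refl = splitSum-all n f g
  splitting (suc n) (suc a') a≤n f g invf invg | inj₁ (s≤s a≤n') = begin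
      splitSum (suc n) a f g
    ≡⟨ sumL-Bᴵ-suc n _ ⟩
      sumL (Bᴵ n) (λ u → sumRange (suc n) 0 (bothSigns n (λ w → f (take a w) * g (drop a w)) u))
    ≡⟨ sumL-cong (Bᴵ n) (All.map (λ {u} lu → insertions-split n a' f g u lu a≤n') (Bᴵ-length n)) ⟩
      sumL (Bᴵ n) (λ u → extendSum n f (take a' u) * g (drop a' u) + f (take a u) * extendSum n g (drop a u))
    ≡⟨ sumL-+ (Bᴵ n) _ _ ⟩
      splitSum n a' (extendSum n f) g + splitSum n a f (extendSum n g)
    ≡⟨ cong₂ _+_ (splitting n a' a'≤n (extendSum n f) g (extendSum-invariant n f invf) (OrderInvariant-mono (n≤1+n _) invg))
                 (splitting n a a≤n' f (extendSum n g) (OrderInvariant-mono (n≤1+n _) invf) (extendSum-invariant n g invg)) ⟩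
      binom n a' * (sumL (Bᴵ a') (extendSum n f) * sumL (Bᴵ (n ∸ a')) g) + binom n a * (A * sumL (Bᴵ (n ∸ a)) (extendSum n g))
    ≡⟨ cong₂ _+_ (cong (λ k → binom n a' * (k * B)) prefix-sum) (cong (λ k → binom n a * (A * k)) suffix-sum) ⟩
      binom n a' * (A * B) + binom n a * (A * B)
    ≡⟨ sym (*-distribʳ-+ (A * B) (binom n a') (binom n a)) ⟩
      binom (suc n) a * (A * B) ∎
    where
    open ≡-Reasoning
    a = suc a'
    a'≤n = <⇒≤ a≤n'
    A = sumL (Bᴵ a) f
    B = sumL (Bᴵ (n ∸ a')) g
    n∸a' : n ∸ a' ≡ suc (n ∸ a)
    n∸a' = +-∸-assoc 1 a≤n'
    prefix-sum : sumL (Bᴵ a') (extendSum n f) ≡ A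
    prefix-sum = sumL-extendSum a' n f invf ≤-refl (s≤s (s≤s a'≤n)) a'≤n
    suffix-sum : sumL (Bᴵ (n ∸ a)) (extendSum n g) ≡ B
    suffix-sum = trans (sumL-extendSum (n ∸ a) n g invg ≤-refl (s≤s (s≤s (m∸n≤m n a))) (m∸n≤m n a))
                       (cong (λ k → sumL (Bᴵ k) g) (sym n∸a'))

module SignedPerms where

  open import Defs
  open Sums
  open Peaks using (_≟L_)
  open Insertion
  open import Data.Nat as ℕ using (ℕ; zero; suc; _+_; _≤_; _<_; z≤n; s≤s)
  open import Data.Nat.Properties
  open import Data.Integer using (ℤ; +_; -[1+_]; ∣_∣)
  open import Data.Bool using (Bool; true; false)
  open import Data.List using (List; []; _∷_; _++_; map; length; upTo; concatMap; cartesianProductWith; cartesianProduct)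
  import Data.List.Properties as LP
  open import Data.List.Relation.Unary.All as All using (All; []; _∷_)
  import Data.List.Relation.Unary.All.Properties as AllP
  open import Data.List.Relation.Unary.Any using (here; there)
  open import Data.List.Relation.Unary.Unique.Propositional using (Unique; []; _∷_)
  import Data.List.Relation.Unary.Unique.Propositional.Properties as UniqueP
  open import Data.List.Membership.Propositional using (_∈_)
  import Data.List.Membership.Propositional.Properties as ∈
  open import Data.Product using (_×_; _,_; proj₁; proj₂)
  open import Data.Sum using (_⊎_; inj₁; inj₂)
  open import Data.Empty using (⊥; ⊥-elim)
  open import Relation.Nullary using (yes; no)
  open import Relation.Binary.PropositionalEquality

  Letter : ℕ → ℤ → Set
  Letter n x = 1 ≤ ∣ x ∣ × ∣ x ∣ ≤ n

  Covers : ℕ → List ℤ → Set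
  Covers n z = ∀ k → 1 ≤ k → k ≤ n → k ∈ map ∣_∣ z

  SignedPerm : ℕ → List ℤ → Set
  SignedPerm n z = length z ≡ n × All (Letter n) z × Covers n z

  private
    ∈-alphabet⁺ : ∀ {n} x → Letter n x → x ∈ alphabet n
    ∈-alphabet⁺ (+ zero) (() , _)
    ∈-alphabet⁺ {n} (+ suc k) (_ , h) = ∈.∈-++⁺ʳ (map (λ k → -[1+ k ]) (upTo n)) (∈.∈-map⁺ (λ k → + suc k) (∈.∈-upTo⁺ h))
    ∈-alphabet⁺ {n} -[1+ k ] (_ , h) = ∈.∈-++⁺ˡ (∈.∈-map⁺ (λ k → -[1+ k ]) (∈.∈-upTo⁺ h))

    ∈-alphabet⁻ : ∀ {n} x → x ∈ alphabet n → Letter n x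
    ∈-alphabet⁻ {n} x m with ∈.∈-++⁻ (map (λ k → -[1+ k ]) (upTo n)) m
    ... | inj₁ m₁ with ∈.∈-map⁻ (λ k → -[1+ k ]) m₁
    ...   | k , mk , refl = s≤s z≤n , ∈.∈-upTo⁻ mk
    ∈-alphabet⁻ {n} x m | inj₂ m₂ with ∈.∈-map⁻ (λ k → + suc k) m₂
    ...   | k , mk , refl = s≤s z≤n , ∈.∈-upTo⁻ mk

    IsSignedPerm⇒Covers : ∀ n z → IsSignedPerm n z → Covers n z
    IsSignedPerm⇒Covers n z h (suc k) _ k≤n = All.lookup h (∈.∈-map⁺ suc (∈.∈-upTo⁺ k≤n))

    Covers⇒IsSignedPerm : ∀ n z → Covers n z → IsSignedPerm n z
    Covers⇒IsSignedPerm n z h = AllP.map⁺ (All.tabulate (λ {k} m → h (suc k) (s≤s z≤n) (∈.∈-upTo⁻ m)))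

    concatMap-cartesian : ∀ (A : List ℤ) (W : List (List ℤ)) → concatMap (λ a → map (a ∷_) W) A ≡ cartesianProductWith _∷_ A W
    concatMap-cartesian [] W = refl
    concatMap-cartesian (a ∷ A) W = cong (map (a ∷_) W ++_) (concatMap-cartesian A W)

    words-suc : ∀ (A : List ℤ) m → words A (suc m) ≡ cartesianProductWith _∷_ A (words A m)
    words-suc A m = concatMap-cartesian A (words A m)

    ∈-words⁻ : ∀ A m {z} → z ∈ words A m → length z ≡ m × All (_∈ A) z
    ∈-words⁻ A zero (here refl) = refl , []
    ∈-words⁻ A (suc m) {z} mz with ∈.∈-cartesianProductWith⁻ _∷_ A (words A m) (subst (z ∈_) (words-suc A m) mz)
    ... | a , z' , ma , mz' , refl with ∈-words⁻ A m mz'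
    ... | l , al = cong suc l , ma ∷ al

    ∈-words⁺ : ∀ A m {z} → length z ≡ m → All (_∈ A) z → z ∈ words A m
    ∈-words⁺ A zero {[]} _ _ = here refl
    ∈-words⁺ A (suc m) {a ∷ z} l (ma ∷ al) = subst ((a ∷ z) ∈_) (sym (words-suc A m))
      (∈.∈-cartesianProductWith⁺ _∷_ ma (∈-words⁺ A m (suc-injective l) al))

    Unique-alphabet : ∀ n → Unique (alphabet n)
    Unique-alphabet n = UniqueP.++⁺ (UniqueP.map⁺ (λ { refl → refl }) (UniqueP.upTo⁺ n)) (UniqueP.map⁺ (λ { refl → refl }) (UniqueP.upTo⁺ n)) disjoint
      where
      disjoint : ∀ {v} → v ∈ map (λ k → -[1+ k ]) (upTo n) × v ∈ map (λ k → + suc k) (upTo n) → ⊥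
      disjoint (m₁ , m₂) with ∈.∈-map⁻ (λ k → -[1+ k ]) m₁ | ∈.∈-map⁻ (λ k → + suc k) m₂
      ... | _ , _ , refl | _ , _ , ()

    Unique-words : ∀ A m → Unique A → Unique (words A m)
    Unique-words A zero uA = [] ∷ []
    Unique-words A (suc m) uA = subst Unique (sym (words-suc A m))
      (UniqueP.cartesianProductWith⁺ _∷_ (λ e → LP.∷-injective e) uA (Unique-words A m uA))

  ∈-B⁻ : ∀ n {z} → z ∈ B n → SignedPerm n z
  ∈-B⁻ n mz with ∈.∈-filter⁻ (isSignedPerm? n) mz
  ... | mw , isp with ∈-words⁻ (alphabet n) n mw
  ... | l , al = l , All.map (λ {x} → ∈-alphabet⁻ x) al , IsSignedPerm⇒Covers n _ isp

  ∈-B⁺ : ∀ n {z} → SignedPerm n z → z ∈ B n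
  ∈-B⁺ n (l , al , cv) = ∈.∈-filter⁺ (isSignedPerm? n) (∈-words⁺ (alphabet n) n l (All.map (λ {x} → ∈-alphabet⁺ x) al)) (Covers⇒IsSignedPerm n _ cv)

  Unique-B : ∀ n → Unique (B n)
  Unique-B n = UniqueP.filter⁺ (isSignedPerm? n) (Unique-words (alphabet n) n (Unique-alphabet n))

  private
    ∈-insertAt : ∀ t X u → X ∈ insertAt t X u
    ∈-insertAt zero X u = here refl
    ∈-insertAt (suc t) X [] = here refl
    ∈-insertAt (suc t) X (y ∷ u) = there (∈-insertAt t X u)

    ∈-insertAt-old : ∀ t X u {y} → y ∈ u → y ∈ insertAt t X u
    ∈-insertAt-old zero X u m = there m
    ∈-insertAt-old (suc t) X (y ∷ u) (here refl) = here refl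
    ∈-insertAt-old (suc t) X (y ∷ u) (there m) = there (∈-insertAt-old t X u m)

    insertAt-signedPerm : ∀ n u t X → ∣ X ∣ ≡ suc n → SignedPerm n u → SignedPerm (suc n) (insertAt t X u)
    insertAt-signedPerm n u t X eX (l , al , cv) =
      trans (length-insertAt t X u) (cong suc l) ,
      All-insertAt t X u (subst (1 ≤_) (sym eX) (s≤s z≤n) , ≤-reflexive eX) (All.map (λ (a , b) → a , m≤n⇒m≤1+n b) al) ,
      covers
      where
      covers : Covers (suc n) (insertAt t X u)
      covers k 1≤k k≤ with m≤n⇒m<n∨m≡n k≤
      ... | inj₂ refl = subst (_∈ map ∣_∣ (insertAt t X u)) eX (∈.∈-map⁺ ∣_∣ (∈-insertAt t X u))
      ... | inj₁ (s≤s k≤n) with ∈.∈-map⁻ ∣_∣ (cv k 1≤k k≤n)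
      ...   | y , my , refl = ∈.∈-map⁺ ∣_∣ (∈-insertAt-old t X u my)

  Bᴵ-signedPerm : ∀ n → All (SignedPerm n) (Bᴵ n)
  Bᴵ-signedPerm zero = (refl , [] , λ k 1≤k k≤0 → ⊥-elim (<-irrefl refl (<-≤-trans 1≤k k≤0))) ∷ []
  Bᴵ-signedPerm (suc n) = All-extendAll n (Bᴵ n)
    (λ w sw t → insertAt-signedPerm n w t _ refl sw , insertAt-signedPerm n w t _ refl sw) (Bᴵ-signedPerm n)

  private
    insertAt-length : ∀ pre X post → insertAt (length pre) X (pre ++ post) ≡ pre ++ X ∷ post
    insertAt-length [] X post = refl
    insertAt-length (y ∷ pre) X post = cong (y ∷_) (insertAt-length pre X post)

    ∈-insertions : ∀ k j p m w t → j ≤ t → t < k + j → insertAt t p w ∈ insertions k j p m w × insertAt t m w ∈ insertions k j p m w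
    ∈-insertions zero j p m w t j≤t t<j = ⊥-elim (<-irrefl refl (<-≤-trans t<j j≤t))
    ∈-insertions (suc k) j p m w t j≤t t< with m≤n⇒m<n∨m≡n j≤t
    ... | inj₂ refl = here refl , there (here refl)
    ... | inj₁ j<t with ∈-insertions k (suc j) p m w t j<t (subst (t <_) (sym (+-suc k j)) t<)
    ...   | a , b = there (there a) , there (there b)

    ∈-extendAll : ∀ n {ws u} → u ∈ ws → ∀ t → t < suc n →
      insertAt t (+ suc n) u ∈ extendAll n ws × insertAt t -[1+ n ] u ∈ extendAll n ws
    ∈-extendAll n {w ∷ ws} (here refl) t lt with ∈-insertions (suc n) 0 (+ suc n) -[1+ n ] w t z≤n (subst (t <_) (sym (+-identityʳ _)) lt)
    ... | a , b = ∈.∈-++⁺ˡ a , ∈.∈-++⁺ˡ b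
    ∈-extendAll n {w ∷ ws} (there m) t lt with ∈-extendAll n m t lt
    ... | a , b = ∈.∈-++⁺ʳ (insertions (suc n) 0 _ _ w) a , ∈.∈-++⁺ʳ (insertions (suc n) 0 _ _ w) b

    pigeonhole : ∀ (V L : List ℕ) → Unique V → All (_∈ L) V → length V ≤ length L
    pigeonhole [] L _ _ = z≤n
    pigeonhole (v ∷ V) L (v∉V ∷ uV) (v∈L ∷ V⊆L) with ∈.∈-∃++ v∈L
    ... | L₁ , L₂ , refl = subst (suc (length V) ≤_) |L|
        (s≤s (pigeonhole V (L₁ ++ L₂) uV (All.zipWith (λ (m , ne) → delete m ne) (V⊆L , v∉V))))
      where
      |L| : suc (length (L₁ ++ L₂)) ≡ length (L₁ ++ v ∷ L₂)
      |L| = trans (cong suc (LP.length-++ L₁)) (trans (sym (+-suc (length L₁) (length L₂))) (sym (LP.length-++ L₁)))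
      delete : ∀ {w} → w ∈ L₁ ++ v ∷ L₂ → v ≢ w → w ∈ L₁ ++ L₂
      delete m ne with ∈.∈-++⁻ L₁ m
      ... | inj₁ a = ∈.∈-++⁺ˡ a
      ... | inj₂ (here refl) = ⊥-elim (ne refl)
      ... | inj₂ (there b) = ∈.∈-++⁺ʳ L₁ b

    abs≡suc : ∀ {n} X → suc n ≡ ∣ X ∣ → (X ≡ + suc n) ⊎ (X ≡ -[1+ n ])
    abs≡suc (+ _) refl = inj₁ refl
    abs≡suc -[1+ _ ] refl = inj₂ refl

  -- Conversely every signed permutation occurs in Bᴵ: delete the letter ±n,
  -- recurse, and re-insert it.
  signedPerm-∈-Bᴵ : ∀ n {z} → SignedPerm n z → z ∈ Bᴵ n
  signedPerm-∈-Bᴵ zero {[]} _ = here refl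
  signedPerm-∈-Bᴵ (suc n) {z} (l , al , cv) with ∈.∈-map⁻ ∣_∣ (cv (suc n) (s≤s z≤n) ≤-refl)
  ... | X , mX , eX with ∈.∈-∃++ mX
  ... | pre , post , refl = subst (_∈ Bᴵ (suc n)) (insertAt-length pre X post) reinsert
    where
    u = pre ++ post
    restore : ∀ {y} → y ∈ u → y ∈ pre ++ X ∷ post
    restore m with ∈.∈-++⁻ pre m
    ... | inj₁ a = ∈.∈-++⁺ˡ a
    ... | inj₂ b = ∈.∈-++⁺ʳ pre (there b)
    |u| : length u ≡ n
    |u| = suc-injective (trans (cong suc (LP.length-++ pre)) (trans (sym (+-suc (length pre) (length post))) (trans (sym (LP.length-++ pre)) l)))
    u-covers : Covers n u
    u-covers k 1≤k k≤n with ∈.∈-map⁻ ∣_∣ (cv k 1≤k (m≤n⇒m≤1+n k≤n))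
    ... | y , my , refl with ∈.∈-++⁻ pre my
    ...   | inj₁ a = ∈.∈-map⁺ ∣_∣ (∈.∈-++⁺ˡ a)
    ...   | inj₂ (here refl) = ⊥-elim (<-irrefl refl (subst (_≤ n) (sym eX) k≤n))
    ...   | inj₂ (there b) = ∈.∈-map⁺ ∣_∣ (∈.∈-++⁺ʳ pre b)
    -- ±(n+1) occurs only once: otherwise n letters of u would cover n+1 values.
    no-second-max : ∀ {y} → y ∈ u → ∣ y ∣ ≢ suc n
    no-second-max {y} my ey = <-irrefl refl (<-≤-trans ≤-refl
       (subst (suc n ≤_) (trans (LP.length-map ∣_∣ u) |u|)
         (subst (_≤ length (map ∣_∣ u)) (trans (LP.length-map suc (upTo (suc n))) (LP.length-upTo (suc n)))
            (pigeonhole (map suc (upTo (suc n))) (map ∣_∣ u) (UniqueP.map⁺ suc-injective (UniqueP.upTo⁺ (suc n)))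
              (AllP.map⁺ (All.tabulate (λ {k} mk → covers-all k (∈.∈-upTo⁻ mk))))))))
      where
      covers-all : ∀ k → k < suc n → suc k ∈ map ∣_∣ u
      covers-all k (s≤s k≤n) with m≤n⇒m<n∨m≡n k≤n
      ... | inj₁ k<n = u-covers (suc k) (s≤s z≤n) k<n
      ... | inj₂ refl = subst (_∈ map ∣_∣ u) ey (∈.∈-map⁺ ∣_∣ my)
    u-letters : All (Letter n) u
    u-letters = All.tabulate (λ {y} my → let (a , b) = All.lookup al (restore my) in a , ≤-pred (≤∧≢⇒< b (no-second-max my)))
    u∈Bᴵ : u ∈ Bᴵ n
    u∈Bᴵ = signedPerm-∈-Bᴵ n (|u| , u-letters , u-covers)
    t<n+1 : length pre < suc n
    t<n+1 = s≤s (subst (length pre ≤_) |u| (subst (length pre ≤_) (sym (LP.length-++ pre)) (m≤m+n _ _)))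
    reinsert : insertAt (length pre) X u ∈ Bᴵ (suc n)
    reinsert with abs≡suc X eX
    ... | inj₁ refl = proj₁ (∈-extendAll n u∈Bᴵ (length pre) t<n+1)
    ... | inj₂ refl = proj₂ (∈-extendAll n u∈Bᴵ (length pre) t<n+1)

  private
    -- Bᴵ (n+1) is the image of Bᴵ n × {insertion codes} under an injective encoding;
    -- the decoding removes the letter of absolute value n+1.
    codes : ℕ → ℕ → List (ℕ × Bool)
    codes zero j = []
    codes (suc k) j = (j , true) ∷ (j , false) ∷ codes k (suc j)

    signed : ℕ → Bool → ℤ
    signed n true = + suc n
    signed n false = -[1+ n ]

    encode : ℕ → List ℤ × (ℕ × Bool) → List ℤ
    encode n (w , t , s) = insertAt t (signed n s) w

    insertions-codes : ∀ k j w n → insertions k j (+ suc n) -[1+ n ] w ≡ map (λ c → encode n (w , c)) (codes k j)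
    insertions-codes zero j w n = refl
    insertions-codes (suc k) j w n = cong (λ r → insertAt j (+ suc n) w ∷ insertAt j -[1+ n ] w ∷ r) (insertions-codes k (suc j) w n)

    extendAll-encode : ∀ n ws → extendAll n ws ≡ map (encode n) (cartesianProduct ws (codes (suc n) 0))
    extendAll-encode n [] = refl
    extendAll-encode n (w ∷ ws) =
      trans (cong₂ _++_ (trans (insertions-codes (suc n) 0 w n) (LP.map-∘ (codes (suc n) 0))) (extendAll-encode n ws))
            (sym (LP.map-++ (encode n) (map (w ,_) (codes (suc n) 0)) _))

    codes-bounds : ∀ k j → All (λ c → j ≤ proj₁ c × proj₁ c < k + j) (codes k j)
    codes-bounds zero j = []
    codes-bounds (suc k) j = (≤-refl , s≤s (m≤n+m j k)) ∷ (≤-refl , s≤s (m≤n+m j k)) ∷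
      All.map (λ {c} (a , b) → <⇒≤ a , subst (proj₁ c <_) (+-suc k j) b) (codes-bounds k (suc j))

    Unique-codes : ∀ k j → Unique (codes k j)
    Unique-codes zero j = []
    Unique-codes (suc k) j = ((λ ()) ∷ later) ∷ (later ∷ Unique-codes k (suc j))
      where
      later : ∀ {b} → All (λ c → (j , b) ≢ c) (codes k (suc j))
      later = All.map (λ (a , _) e → <-irrefl (cong proj₁ e) a) (codes-bounds k (suc j))

    sign : ℤ → Bool
    sign (+ _) = true
    sign -[1+ _ ] = false

    decode : ℕ → List ℤ → List ℤ × (ℕ × Bool)
    decode N [] = [] , 0 , true
    decode N (x ∷ z) with ∣ x ∣ ℕ.≟ N
    ... | yes _ = z , 0 , sign x
    ... | no _ = (x ∷ proj₁ (decode N z)) , suc (proj₁ (proj₂ (decode N z))) , proj₂ (proj₂ (decode N z))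

    decode-encode : ∀ n w t s → All (λ y → ∣ y ∣ ≢ suc n) w → t ≤ length w → decode (suc n) (encode n (w , t , s)) ≡ (w , t , s)
    decode-encode n w zero true _ _ with suc n ℕ.≟ suc n
    ... | yes _ = refl
    ... | no ne = ⊥-elim (ne refl)
    decode-encode n w zero false _ _ with suc n ℕ.≟ suc n
    ... | yes _ = refl
    ... | no ne = ⊥-elim (ne refl)
    decode-encode n (y ∷ w) (suc t) s (y≢ ∷ w≢) (s≤s t≤) with ∣ y ∣ ℕ.≟ suc n
    ... | yes e = ⊥-elim (y≢ e)
    ... | no _ rewrite decode-encode n w t s w≢ t≤ = refl

    Unique-map : ∀ {A B : Set} (f : A → B) (g : B → A) {xs} → Unique xs → (∀ {x} → x ∈ xs → g (f x) ≡ x) → Unique (map f xs)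
    Unique-map f g [] h = []
    Unique-map f g {x ∷ xs} (x∉ ∷ u) h = AllP.map⁺ (All.tabulate (λ {y} m e → All.lookup x∉ m
       (trans (sym (h (here refl))) (trans (cong g e) (h (there m)))))) ∷ Unique-map f g u (λ m → h (there m))

  Unique-Bᴵ : ∀ n → Unique (Bᴵ n)
  Unique-Bᴵ zero = [] ∷ []
  Unique-Bᴵ (suc n) = subst Unique (sym (extendAll-encode n (Bᴵ n)))
    (Unique-map (encode n) (decode (suc n)) (UniqueP.cartesianProduct⁺ (Unique-Bᴵ n) (Unique-codes (suc n) 0)) left-inverse)
    where
    left-inverse : ∀ {x} → x ∈ cartesianProduct (Bᴵ n) (codes (suc n) 0) → decode (suc n) (encode n x) ≡ x
    left-inverse {w , t , s} m with ∈.∈-cartesianProduct⁻ (Bᴵ n) (codes (suc n) 0) m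
    ... | mw , mc = decode-encode n w t s (All.map (λ lt e → <-irrefl e lt) (All.lookup (Bᴵ-bounded n) mw))
         (subst (t ≤_) (sym (All.lookup (Bᴵ-length n) mw)) (≤-pred (subst (t <_) (+-identityʳ _) (proj₂ (All.lookup (codes-bounds (suc n) 0) mc)))))

  sumL-B : ∀ n (f : List ℤ → ℕ) → sumL (B n) f ≡ sumL (Bᴵ n) f
  sumL-B n f = sumL-sameElements (B n) (Bᴵ n) f (Unique-B n) (Unique-Bᴵ n)
    (λ m → signedPerm-∈-Bᴵ n (∈-B⁻ n m)) (λ m → ∈-B⁺ n (All.lookup (Bᴵ-signedPerm n) m))

  count : List ℕ → ℕ → ℕ
  count T n = sumL (Bᴵ n) (λ w → 𝟙 (PB w ≟L T))

  countPB≡count : ∀ S n → countPB S n ≡ count S n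
  countPB≡count S n = trans (length-filter-sumL (λ w → PB w ≟L S) (B n)) (sumL-B n _)

module Monotone where

  open Sums
  open Peaks using (SameRank; OrderIso; []; _∷_)
  open Insertion
  open import Data.Nat using (ℕ; zero; suc; _+_; _*_; _^_; _<_; s≤s)
  open import Data.Nat.Properties
  open import Data.Integer using (ℤ; +_; -[1+_]) renaming (_<_ to _<ᶻ_)
  import Data.Integer.Properties as ℤP
  open import Data.List using (List; []; _∷_; length)
  open import Data.List.Relation.Unary.All as All using (All; []; _∷_)
  open import Data.List.Relation.Unary.Linked using (Linked; []; [-]; _∷_; linked?)
  open import Data.Product using (_×_; _,_; proj₁; proj₂)
  open import Data.Sum using (_⊎_; inj₁; inj₂)
  open import Relation.Nullary using (Dec; ¬_)
  open import Relation.Binary.PropositionalEquality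

  isChain : {R : ℤ → ℤ → Set} → (∀ x y → Dec (R x y)) → List ℤ → ℕ
  isChain R? w = 𝟙 (linked? R? w)

  >ᶻ? : ∀ x y → Dec (y <ᶻ x)
  >ᶻ? x y = y ℤP.<? x

  isIncreasing isDecreasing : List ℤ → ℕ
  isIncreasing = isChain ℤP._<?_
  isDecreasing = isChain >ᶻ?

  linked-orderIso : ∀ {R : ℤ → ℤ → Set} → (∀ {x y a b u v} → SameRank x y (a ∷ u) (b ∷ v) → Iff (R x a) (R y b)) →
    ∀ {u v} → OrderIso u v → Iff (Linked R u) (Linked R v)
  linked-orderIso h [] = (λ _ → []) , (λ _ → [])
  linked-orderIso h (_∷_ {u = []} {[]} [] []) = (λ _ → [-]) , (λ _ → [-])
  linked-orderIso h (_∷_ {u = a ∷ u} {b ∷ v} c iso) =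
    (λ { (r ∷ m) → proj₁ (h c) r ∷ proj₁ (linked-orderIso h iso) m }) ,
    (λ { (r ∷ m) → proj₂ (h c) r ∷ proj₂ (linked-orderIso h iso) m })

  isIncreasing-invariant : ∀ b → OrderInvariant b isIncreasing
  isIncreasing-invariant b {u} {v} _ _ iso =
    𝟙-iff (linked? ℤP._<?_ u) (linked? ℤP._<?_ v) (linked-orderIso (λ { ((e , _) ∷ _) → e }) iso)

  isDecreasing-invariant : ∀ b → OrderInvariant b isDecreasing
  isDecreasing-invariant b {u} {v} _ _ iso =
    𝟙-iff (linked? >ᶻ? u) (linked? >ᶻ? v) (linked-orderIso (λ { ((_ , e) ∷ _) → e }) iso)

  -- X is strictly R-before (resp. after) y; a letter R-before all others can
  -- only stand first in an R-chain, one R-after all others only last.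
  Before After : (ℤ → ℤ → Set) → ℤ → ℤ → Set
  Before R X y = R X y × ¬ R y X
  After R X y = R y X × ¬ R X y

  private

    linked-first : ∀ {R} X w → All (Before R X) w → Iff (Linked R (insertAt 0 X w)) (Linked R w)
    linked-first X [] _ = (λ _ → []) , (λ _ → [-])
    linked-first X (y ∷ w) ((r , _) ∷ _) = (λ { (_ ∷ m) → m }) , (λ m → r ∷ m)

    not-linked-first : ∀ {R} X t y w → All (Before R X) (y ∷ w) → ¬ Linked R (insertAt (suc t) X (y ∷ w))
    not-linked-first X zero y w ((_ , ¬r) ∷ _) (r ∷ _) = ¬r r
    not-linked-first X (suc t) y [] ((_ , ¬r) ∷ _) (r ∷ _) = ¬r r
    not-linked-first X (suc t) y (z ∷ w) (_ ∷ bs) (_ ∷ m) = not-linked-first X t z w bs m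

    linked-last : ∀ {R} X w → All (After R X) w → Iff (Linked R (insertAt (length w) X w)) (Linked R w)
    linked-last X [] _ = (λ _ → []) , (λ _ → [-])
    linked-last X (y ∷ []) ((r , _) ∷ _) = (λ _ → [-]) , (λ _ → r ∷ [-])
    linked-last X (y ∷ z ∷ w) (_ ∷ as) =
      (λ { (r ∷ m) → r ∷ proj₁ (linked-last X (z ∷ w) as) m }) , (λ { (r ∷ m) → r ∷ proj₂ (linked-last X (z ∷ w) as) m })

    not-linked-last : ∀ {R} X t w → t < length w → All (After R X) w → ¬ Linked R (insertAt t X w)
    not-linked-last X zero (y ∷ w) _ ((_ , ¬r) ∷ _) (r ∷ _) = ¬r r
    not-linked-last X (suc zero) (y ∷ z ∷ w) _ (_ ∷ (_ , ¬r) ∷ _) (_ ∷ r ∷ _) = ¬r r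
    not-linked-last X (suc (suc t)) (y ∷ z ∷ w) (s≤s t<) (_ ∷ as) (_ ∷ m) = not-linked-last X (suc t) (z ∷ w) t< as m
    not-linked-last X (suc t) (y ∷ []) (s≤s ()) _

  module _ {R : ℤ → ℤ → Set} (R? : ∀ x y → Dec (R x y)) where

    -- Inserting a letter that must come first: only position 0 can give a chain.
    insert-first : ∀ n w X → length w ≡ n → All (Before R X) w →
      sumRange (suc n) 0 (λ t → isChain R? (insertAt t X w)) ≡ isChain R? w
    insert-first n [] X refl _ = refl
    insert-first n (y ∷ w) X _ bs =
      trans (cong₂ _+_ (𝟙-iff (linked? R? _) (linked? R? (y ∷ w)) (linked-first X (y ∷ w) bs))
                       (sumRange-zero n 1 _ λ { zero () _ ; (suc t) _ _ → 𝟙-no (linked? R? _) (not-linked-first X t y w bs) }))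
            (+-identityʳ _)

    -- Inserting a letter that must come last: only the final position can give a chain.
    insert-last : ∀ n w X → length w ≡ n → All (After R X) w →
      sumRange (suc n) 0 (λ t → isChain R? (insertAt t X w)) ≡ isChain R? w
    insert-last n w X lw as = trans (sumRange-last n 0 _)
      (cong₂ _+_ (sumRange-zero n 0 _ λ t _ t< → 𝟙-no (linked? R? _)
                    (not-linked-last X t w (subst (t <_) (trans (+-identityʳ n) (sym lw)) t<) as))
                 (𝟙-iff (linked? R? _) (linked? R? w)
                    (subst (λ k → Iff (Linked R (insertAt k X w)) (Linked R w)) (trans lw (sym (+-identityʳ n))) (linked-last X w as))))

    OppositeExtremes : ℕ → List ℤ → Set
    OppositeExtremes n w =
      (All (After R (+ suc n)) w × All (Before R -[1+ n ]) w) ⊎ (All (Before R (+ suc n)) w × All (After R -[1+ n ]) w)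

    chain-doubles : ∀ n w → length w ≡ n → OppositeExtremes n w →
      sumRange (suc n) 0 (bothSigns n (isChain R?) w) ≡ 2 * isChain R? w
    chain-doubles n w lw extremal =
      trans (sumRange-+ (suc n) 0 (λ t → isChain R? (insertAt t (+ suc n) w)) (λ t → isChain R? (insertAt t -[1+ n ] w)))
        (trans (cong₂ _+_ (plus extremal) (minus extremal)) (cong (λ k → isChain R? w + k) (sym (+-identityʳ _))))
      where
      plus : OppositeExtremes n w → sumRange (suc n) 0 (λ t → isChain R? (insertAt t (+ suc n) w)) ≡ isChain R? w
      plus (inj₁ (as , _)) = insert-last n w _ lw as
      plus (inj₂ (bs , _)) = insert-first n w _ lw bs
      minus : OppositeExtremes n w → sumRange (suc n) 0 (λ t → isChain R? (insertAt t -[1+ n ] w)) ≡ isChain R? w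
      minus (inj₁ (_ , bs)) = insert-first n w _ lw bs
      minus (inj₂ (_ , as)) = insert-last n w _ lw as

  sumL-doubling : (f : List ℤ → ℕ) →
    (∀ n w → length w ≡ n → Bounded (suc n) w → sumRange (suc n) 0 (bothSigns n f w) ≡ 2 * f w) →
    ∀ n → sumL (Bᴵ n) f ≡ 2 ^ n * f []
  sumL-doubling f doubles zero = refl
  sumL-doubling f doubles (suc n) =
    trans (sumL-Bᴵ-suc n f)
      (trans (sumL-cong (Bᴵ n) (All.zipWith (λ {w} (lw , bw) → doubles n w lw bw) (Bᴵ-length n , Bᴵ-bounded n)))
        (trans (sumL-*ˡ (Bᴵ n) f 2) (trans (cong (2 *_) (sumL-doubling f doubles n)) (sym (*-assoc 2 (2 ^ n) (f []))))))

  -- There are 2^n increasing and 2^n decreasing signed permutations of length n: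
  -- -(n+1) must be inserted first and n+1 last (or the reverse).
  increasing-count : ∀ n → sumL (Bᴵ n) isIncreasing ≡ 2 ^ n
  increasing-count n = trans (sumL-doubling _ doubles n) (*-identityʳ (2 ^ n))
    where
    doubles : ∀ n w → length w ≡ n → Bounded (suc n) w → sumRange (suc n) 0 (bothSigns n isIncreasing w) ≡ 2 * isIncreasing w
    doubles n w lw bw = chain-doubles ℤP._<?_ n w lw
      (inj₁ (All.map (λ h → h , ℤP.<-asym h) (below-top bw) , All.map (λ h → h , ℤP.<-asym h) (above-bottom bw)))

  decreasing-count : ∀ n → sumL (Bᴵ n) isDecreasing ≡ 2 ^ n
  decreasing-count n = trans (sumL-doubling _ doubles n) (*-identityʳ (2 ^ n))
    where
    doubles : ∀ n w → length w ≡ n → Bounded (suc n) w → sumRange (suc n) 0 (bothSigns n isDecreasing w) ≡ 2 * isDecreasing w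
    doubles n w lw bw = chain-doubles >ᶻ? n w lw
      (inj₂ (All.map (λ h → h , ℤP.<-asym h) (below-top bw) , All.map (λ h → h , ℤP.<-asym h) (above-bottom bw)))

module Peakless where

  open import Defs
  open Sums
  open Peaks
  open Insertion
  open Splitting
  open Monotone
  open SignedPerms using (count)
  open import Data.Nat using (ℕ; zero; suc; _+_; _*_; _∸_; _^_; _<_; z≤n; s≤s)
  open import Data.Nat.Properties
  open import Data.Integer using (ℤ; +_; -[1+_]; ∣_∣) renaming (_<_ to _<ᶻ_)
  import Data.Integer.Properties as ℤP
  open import Data.Unit using (⊤; tt)
  open import Data.List using (List; []; _∷_; _++_; length; take; drop)
  import Data.List.Properties as LP
  open import Data.List.Relation.Unary.All as All using (All; []; _∷_)
  import Data.List.Relation.Unary.All.Properties as AllP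
  open import Data.List.Relation.Unary.Linked using (Linked; []; [-]; _∷_; linked?)
  import Data.List.Relation.Unary.Linked as Linked
  open import Data.List.Relation.Unary.Unique.Propositional using (Unique; []; _∷_)
  open import Data.Product using (_×_; _,_; proj₁; proj₂)
  open import Data.Empty using (⊥-elim)
  open import Relation.Nullary using (yes; no; ¬_; _×-dec_)
  open import Relation.Binary.PropositionalEquality
  open import Data.Nat.Solver using (module +-*-Solver)
  open +-*-Solver using (solve; _:+_; _:*_; _:=_; con)

  Unique-insertAt : ∀ t X u → All (X ≢_) u → Unique u → Unique (insertAt t X u)
  Unique-insertAt zero X u X∉u uu = X∉u ∷ uu
  Unique-insertAt (suc t) X [] _ _ = [] ∷ []
  Unique-insertAt (suc t) X (y ∷ u) (X≢y ∷ X∉u) (y∉u ∷ uu) =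
    All-insertAt t X u (λ e → X≢y (sym e)) y∉u ∷ Unique-insertAt t X u X∉u uu

  Bᴵ-distinct : ∀ n → All Unique (Bᴵ n)
  Bᴵ-distinct zero = [] ∷ []
  Bᴵ-distinct (suc n) = All-extendAll n (Bᴵ n) (λ w (uw , bw) t → fresh w uw bw t refl , fresh w uw bw t refl)
    (All.zipWith (λ x → x) (Bᴵ-distinct n , Bᴵ-bounded n))
    where
    fresh : ∀ w → Unique w → Bounded (suc n) w → ∀ t {X} → ∣ X ∣ ≡ suc n → Unique (insertAt t X w)
    fresh w uw bw t eX = Unique-insertAt t _ w (All.map (λ lt e → <-irrefl (trans (cong ∣_∣ (sym e)) eX) lt) bw) uw

  private
    StartsAbove : ℤ → List ℤ → Set
    StartsAbove x [] = ⊤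
    StartsAbove x (y ∷ _) = x <ᶻ y

    below-left : ∀ {x y z : ℤ} → ¬ (x <ᶻ y × z <ᶻ y) → z <ᶻ y → x ≢ y → y <ᶻ x
    below-left ¬peak z<y x≢y = ℤP.≤∧≢⇒< (ℤP.≮⇒≥ (λ x<y → ¬peak (x<y , z<y))) (λ e → x≢y (sym e))

    peakless-ascent : ∀ i x R → Unique R → StartsAbove x R → Iff (peaksFrom i (x ∷ R) ≡ []) (Linked _<ᶻ_ R)
    peakless-ascent i x [] _ _ = (λ _ → []) , (λ _ → refl)
    peakless-ascent i x (y ∷ []) _ _ = (λ _ → [-]) , (λ _ → refl)
    peakless-ascent i x (y ∷ z ∷ R) ((y≢z ∷ _) ∷ uR) x<y with (x ℤP.<? y) ×-dec (z ℤP.<? y)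
    ... | yes (_ , z<y) = (λ ()) , (λ { (y<z ∷ _) → ⊥-elim (ℤP.<-asym z<y y<z) })
    ... | no ¬peak = (λ e → y<z ∷ proj₁ IH e) , (λ { (_ ∷ m) → proj₂ IH m })
      where
      y<z : y <ᶻ z
      y<z = ℤP.≤∧≢⇒< (ℤP.≮⇒≥ (λ z<y → ¬peak (x<y , z<y))) y≢z
      IH : Iff (peaksFrom (suc i) (y ∷ z ∷ R) ≡ []) (Linked _<ᶻ_ (z ∷ R))
      IH = peakless-ascent (suc i) y (z ∷ R) uR y<z

  peakless-valley : ∀ i L X R → Unique (L ++ X ∷ R) → All (X <ᶻ_) L → All (X <ᶻ_) R →
    Iff (peaksFrom i (L ++ X ∷ R) ≡ []) (Linked (λ x y → y <ᶻ x) L × Linked _<ᶻ_ R)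
  peakless-valley i [] X R (_ ∷ uR) _ X<R = (λ e → [] , proj₁ IH e) , (λ (_ , m) → proj₂ IH m)
    where
    starts : ∀ {R} → All (X <ᶻ_) R → StartsAbove X R
    starts [] = tt
    starts (h ∷ _) = h
    IH : Iff (peaksFrom i (X ∷ R) ≡ []) (Linked _<ᶻ_ R)
    IH = peakless-ascent i X R uR (starts X<R)
  peakless-valley i (x ∷ []) X [] _ _ _ = (λ _ → [-] , []) , (λ _ → refl)
  peakless-valley i (x ∷ []) X (r ∷ R) (_ ∷ _ ∷ uR) (X<x ∷ _) (X<r ∷ _) with (x ℤP.<? X) ×-dec (r ℤP.<? X)
  ... | yes (x<X , _) = ⊥-elim (ℤP.<-asym x<X X<x)
  ... | no _ = (λ e → [-] , proj₁ IH e) , (λ (_ , m) → proj₂ IH m)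
    where
    IH : Iff (peaksFrom (suc i) (X ∷ r ∷ R) ≡ []) (Linked _<ᶻ_ (r ∷ R))
    IH = peakless-ascent (suc i) X (r ∷ R) uR X<r
  peakless-valley i (x ∷ y ∷ []) X R ((x≢y ∷ _) ∷ u) (_ ∷ X<y ∷ []) X<R with (x ℤP.<? y) ×-dec (X ℤP.<? y)
  ... | yes (x<y , _) = (λ ()) , (λ { ((y<x ∷ _) , _) → ⊥-elim (ℤP.<-asym x<y y<x) })
  ... | no ¬peak = (λ e → (below-left ¬peak X<y x≢y ∷ [-]) , proj₂ (proj₁ IH e)) , (λ (_ , m) → proj₂ IH ([-] , m))
    where
    IH : Iff (peaksFrom (suc i) (y ∷ X ∷ R) ≡ []) (Linked (λ x y → y <ᶻ x) (y ∷ []) × Linked _<ᶻ_ R)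
    IH = peakless-valley (suc i) (y ∷ []) X R u (X<y ∷ []) X<R
  peakless-valley i (x ∷ y ∷ z ∷ L) X R ((x≢y ∷ _) ∷ u) (_ ∷ X<L) X<R with (x ℤP.<? y) ×-dec (z ℤP.<? y)
  ... | yes (x<y , _) = (λ ()) , (λ { ((y<x ∷ _) , _) → ⊥-elim (ℤP.<-asym x<y y<x) })
  ... | no ¬peak = (λ e → let (dec , inc) = proj₁ IH e in (below-left ¬peak (Linked.head dec) x≢y ∷ dec) , inc) ,
                   (λ { ((_ ∷ dec) , inc) → proj₂ IH (dec , inc) })
    where
    IH : Iff (peaksFrom (suc i) (y ∷ z ∷ L ++ X ∷ R) ≡ []) (Linked (λ x y → y <ᶻ x) (y ∷ z ∷ L) × Linked _<ᶻ_ R)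
    IH = peakless-valley (suc i) (y ∷ z ∷ L) X R u X<L X<R

  private
    peakHere-below : ∀ i a rest acc → All (_<ᶻ a) rest → peakHere i a rest acc ≡ acc
    peakHere-below i a [] acc _ = refl
    peakHere-below i a (b ∷ []) acc _ = refl
    peakHere-below i a (b ∷ c ∷ r) acc (b<a ∷ _) with (a ℤP.<? b) ×-dec (c ℤP.<? b)
    ... | yes (a<b , _) = ⊥-elim (ℤP.<-asym a<b b<a)
    ... | no _ = refl

    seamPeaks-max : ∀ i w X → All (_<ᶻ X) w → seamPeaks i w (X ∷ []) ≡ []
    seamPeaks-max i [] X _ = refl
    seamPeaks-max i (x ∷ []) X _ = refl
    seamPeaks-max i (x ∷ y ∷ []) X (_ ∷ y<X ∷ _) with (x ℤP.<? y) ×-dec (X ℤP.<? y)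
    ... | yes (_ , X<y) = ⊥-elim (ℤP.<-asym X<y y<X)
    ... | no _ = refl
    seamPeaks-max i (x ∷ y ∷ z ∷ w) X (_ ∷ w<X) = seamPeaks-max (suc i) (y ∷ z ∷ w) X w<X

    insertAt-end : ∀ X w → insertAt (length w) X w ≡ w ++ X ∷ []
    insertAt-end X [] = refl
    insertAt-end X (y ∷ w) = cong (y ∷_) (insertAt-end X w)

    insertAt≡take++drop : ∀ t X w → insertAt t X w ≡ take t w ++ X ∷ drop t w
    insertAt≡take++drop zero X w = refl
    insertAt≡take++drop (suc t) X [] = refl
    insertAt≡take++drop (suc t) X (y ∷ w) = cong (y ∷_) (insertAt≡take++drop t X w)

    peakHere-≢[] : ∀ i a rest acc → acc ≢ [] → peakHere i a rest acc ≢ []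
    peakHere-≢[] i a rest acc acc≢[] e = acc≢[] (suffix-[] (peakHere i a rest []) (trans (sym (peakHere-++ i a rest acc)) e))
      where
      suffix-[] : ∀ (xs : List ℕ) {ys} → xs ++ ys ≡ [] → ys ≡ []
      suffix-[] [] e = e

  peakless : List ℤ → ℕ
  peakless w = 𝟙 (PB w ≟L [])

  -- Inserting a new maximum P into a peakless word keeps it peakless only at the
  -- two ends; at either end the peak set is unchanged.
  private
    peakless-max-first : ∀ P w → All (_<ᶻ P) w → Iff (peaksFrom 1 (P ∷ w) ≡ []) (PB w ≡ [])
    peakless-max-first P w w<P = (λ e → peakless-shift 2 1 w (trans (sym (peakHere-below 1 P w _ w<P)) e)) ,
                                 (λ e → trans (peakHere-below 1 P w _ w<P) (peakless-shift 1 2 w e))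

    PB-max-last : ∀ P w → All (_<ᶻ P) w → PB (insertAt (length w) P w) ≡ PB w
    PB-max-last P w w<P = trans (cong PB (insertAt-end P w))
      (trans (PB-++ w (P ∷ [])) (trans (cong (λ m → PB w ++ m ++ []) (seamPeaks-max 1 w P w<P)) (LP.++-identityʳ (PB w))))

    max-inside-is-peak : ∀ i P t w → 0 < t → t < length w → All (_<ᶻ P) w → peaksFrom i (insertAt t P w) ≢ []
    max-inside-is-peak i P (suc zero) (y ∷ z ∷ w) _ _ (y<P ∷ z<P ∷ _) with (y ℤP.<? P) ×-dec (z ℤP.<? P)
    ... | yes _ = λ ()
    ... | no ¬peak = ⊥-elim (¬peak (y<P , z<P))
    max-inside-is-peak i P (suc zero) (y ∷ []) _ (s≤s ()) _
    max-inside-is-peak i P (suc (suc t)) (y ∷ w) _ (s≤s t<) (_ ∷ w<P) =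
      peakHere-≢[] i y (insertAt (suc t) P w) _ (max-inside-is-peak (suc i) P (suc t) w (s≤s z≤n) t< w<P)

  insert-max-doubles : ∀ n w → length w ≡ suc n → All (_<ᶻ + suc (suc n)) w →
    sumRange (suc (suc n)) 0 (λ t → peakless (insertAt t (+ suc (suc n)) w)) ≡ peakless w + peakless w
  insert-max-doubles n w lw w<P = begin
      sumRange (suc (suc n)) 0 H
    ≡⟨ cong (λ k → H 0 + k) (sumRange-last n 1 H) ⟩
      H 0 + (sumRange n 1 H + H (n + 1))
    ≡⟨ cong₂ (λ u v → H 0 + (u + v))
         (sumRange-zero n 1 H (λ t 1≤t t< → 𝟙-no (_ ≟L []) (max-inside-is-peak 1 P t w 1≤t (subst (t <_) (trans (+-comm n 1) (sym lw)) t<) w<P)))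
         (cong H (trans (+-comm n 1) (sym lw))) ⟩
      H 0 + (0 + H (length w))
    ≡⟨ cong₂ _+_ (𝟙-iff (_ ≟L []) (_ ≟L []) (peakless-max-first P w w<P)) (cong (λ l → 𝟙 (l ≟L [])) (PB-max-last P w w<P)) ⟩
      peakless w + peakless w ∎
    where
    open ≡-Reasoning
    P = + suc (suc n)
    H : ℕ → ℕ
    H t = peakless (insertAt t P w)

  peakless-insert-min : ∀ n w t → Unique w → Bounded (suc n) w →
    peakless (insertAt t -[1+ n ] w) ≡ isDecreasing (take t w) * isIncreasing (drop t w)
  peakless-insert-min n w t uw bw = trans
    (𝟙-iff (_ ≟L []) (linked? >ᶻ? (take t w) ×-dec linked? ℤP._<?_ (drop t w))
      (subst (λ z → Iff (PB z ≡ []) (Linked (λ x y → y <ᶻ x) (take t w) × Linked _<ᶻ_ (drop t w))) (sym (insertAt≡take++drop t M w))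
        (peakless-valley 1 (take t w) M (drop t w)
          (subst Unique (insertAt≡take++drop t M w) (Unique-insertAt t M w (All.map (λ lt e → <-irrefl (cong ∣_∣ (sym e)) lt) bw) uw))
          (AllP.take⁺ t (above-bottom bw)) (AllP.drop⁺ t (above-bottom bw)))))
    (𝟙-× (linked? >ᶻ? (take t w)) (linked? ℤP._<?_ (drop t w)))
    where M = -[1+ n ]

  -- Summed over B_n and all positions, the minimum insertions give 4^n peakless
  -- words: Σ_t C(n,t) 2^t 2^{n-t} by the splitting theorem.
  insert-min-total : ∀ n → sumL (Bᴵ n) (λ w → sumRange (suc n) 0 (λ t → peakless (insertAt t -[1+ n ] w))) ≡ 2 ^ n * 2 ^ n
  insert-min-total n = begin
      sumL (Bᴵ n) (λ w → sumRange (suc n) 0 (λ t → peakless (insertAt t -[1+ n ] w)))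
    ≡⟨ sumL-cong (Bᴵ n) (All.zipWith (λ {w} (uw , bw) → sumRange-cong (suc n) 0 (λ t _ → peakless-insert-min n w t uw bw))
                                       (Bᴵ-distinct n , Bᴵ-bounded n)) ⟩
      sumL (Bᴵ n) (λ w → sumRange (suc n) 0 (λ t → G t w))
    ≡⟨ sumL-sumRange (Bᴵ n) (suc n) 0 G ⟩
      sumRange (suc n) 0 (λ t → splitSum n t isDecreasing isIncreasing)
    ≡⟨ sumRange-cong (suc n) 0 (λ t t< → let t≤n = ≤-pred t< in
         trans (splitting n t t≤n isDecreasing isIncreasing (isDecreasing-invariant _) (isIncreasing-invariant _))
           (cong (binom n t *_) (trans (cong₂ _*_ (decreasing-count t) (increasing-count (n ∸ t)))
             (trans (sym (^-distribˡ-+-* 2 t (n ∸ t))) (cong (2 ^_) (m+[n∸m]≡n t≤n)))))) ⟩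
      sumRange (suc n) 0 (λ t → binom n t * 2 ^ n)
    ≡⟨ sumRange-*ʳ (suc n) 0 (binom n) (2 ^ n) ⟩
      sumRange (suc n) 0 (binom n) * 2 ^ n
    ≡⟨ cong (_* 2 ^ n) (binom-row-sum n) ⟩
      2 ^ n * 2 ^ n ∎
    where
    open ≡-Reasoning
    G : ℕ → List ℤ → ℕ
    G t w = isDecreasing (take t w) * isIncreasing (drop t w)

  -- #P_B(∅, k+1) = 2·4^k: inserting n+2 doubles, inserting -(n+2) adds 4^{n+1}.
  peakless-count : ∀ k → count [] (suc k) ≡ 2 * (2 ^ k * 2 ^ k)
  peakless-count zero = refl
  peakless-count (suc n) = begin
      count [] (suc (suc n))
    ≡⟨ sumL-Bᴵ-suc (suc n) peakless ⟩
      sumL (Bᴵ (suc n)) (λ w → sumRange (suc (suc n)) 0 (bothSigns (suc n) peakless w))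
    ≡⟨ sumL-ext (Bᴵ (suc n)) (λ w → sumRange-+ (suc (suc n)) 0 (λ t → peakless (insertAt t (+ suc (suc n)) w))
                                                                (λ t → peakless (insertAt t -[1+ suc n ] w))) ⟩
      sumL (Bᴵ (suc n)) (λ w → sumRange (suc (suc n)) 0 (λ t → peakless (insertAt t (+ suc (suc n)) w)) +
                               sumRange (suc (suc n)) 0 (λ t → peakless (insertAt t -[1+ suc n ] w)))
    ≡⟨ sumL-+ (Bᴵ (suc n)) _ _ ⟩
      sumL (Bᴵ (suc n)) (λ w → sumRange (suc (suc n)) 0 (λ t → peakless (insertAt t (+ suc (suc n)) w))) +
      sumL (Bᴵ (suc n)) (λ w → sumRange (suc (suc n)) 0 (λ t → peakless (insertAt t -[1+ suc n ] w)))
    ≡⟨ cong₂ _+_ (sumL-cong (Bᴵ (suc n)) (All.zipWith (λ {w} (lw , bw) → insert-max-doubles n w lw (below-top bw))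
                                                      (Bᴵ-length (suc n) , Bᴵ-bounded (suc n))))
                 (insert-min-total (suc n)) ⟩
      sumL (Bᴵ (suc n)) (λ w → peakless w + peakless w) + 2 ^ suc n * 2 ^ suc n
    ≡⟨ cong (_+ 2 ^ suc n * 2 ^ suc n) (trans (sumL-twice (Bᴵ (suc n)) peakless) (cong (2 *_) (peakless-count n))) ⟩
      2 * (2 * (2 ^ n * 2 ^ n)) + (2 * 2 ^ n) * (2 * 2 ^ n)
    ≡⟨ arith (2 ^ n) ⟩
      2 * (2 ^ suc n * 2 ^ suc n) ∎
    where
    open ≡-Reasoning
    arith : ∀ a → 2 * (2 * (a * a)) + (2 * a) * (2 * a) ≡ 2 * ((2 * a) * (2 * a))
    arith = solve 1 (λ a → con 2 :* (con 2 :* (a :* a)) :+ (con 2 :* a) :* (con 2 :* a) := con 2 :* ((con 2 :* a) :* (con 2 :* a))) refl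

module PeakCounts where

  open import Defs
  open Sums
  open Peaks
  open Insertion
  open Splitting
  open SignedPerms using (count)
  open import Data.Nat using (ℕ; suc; _+_; _*_; _∸_; _≤_; _<_; _≟_)
  open import Data.Nat.Properties
  open import Data.Integer using (ℤ)
  open import Data.List using (List; []; _∷_; _++_; length; take; drop)
  import Data.List.Properties as LP
  open import Data.List.Relation.Unary.All as All using (All)
  open import Data.Product using (Σ; _×_; _,_; proj₁; proj₂)
  open import Data.Empty using (⊥-elim)
  open import Relation.Nullary using (yes; no; ¬_)
  open import Relation.Binary.PropositionalEquality

  count-witness : ∀ T n → count T n ≢ 0 → Σ (List ℤ) λ w → length w ≡ n × PB w ≡ T
  count-witness T n ne with sumL-nonzero (Bᴵ n) _ ne
  ... | w , w∈ , fw≢0 with PB w ≟L T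
  ...   | yes e = w , All.lookup (Bᴵ-length n) w∈ , e
  ...   | no _ = ⊥-elim (fw≢0 refl)

  count-valid : ∀ T n → count T n ≢ 0 → ValidPeakSet T × All (λ p → suc p ≤ n) T
  count-valid T n ne with count-witness T n ne
  ... | w , refl , refl = PB-valid w , All.map proj₂ (PB-bounds w)

  count-length : ∀ T n → count T n ≢ 0 → length T ≤ n
  count-length T n ne with count-witness T n ne
  ... | w , refl , refl = length-peaksFrom 1 w

  count-invalid : ∀ T n → ¬ ValidPeakSet T → count T n ≡ 0
  count-invalid T n ¬valid with count T n ≟ 0
  ... | yes e = e
  ... | no ne = ⊥-elim (¬valid (proj₁ (count-valid T n ne)))

  PB-invariant : ∀ b T → OrderInvariant b (λ w → 𝟙 (PB w ≟L T))
  PB-invariant b T _ _ iso = cong (λ l → 𝟙 (l ≟L T)) (peaksFrom-orderIso 1 iso)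

  -- The basic recursion, for 1 ≤ a ≤ n and T ⊆ [1, a):
  --   C(n,a)·#P(T,a)·#P(∅,n-a) = #P(T,n) + #P(T∪{a},n) + #P(T∪{a+1},n).
  -- Sum the peak-splitting identity over B_n and apply the splitting theorem.
  count-split : ∀ n a T → 1 ≤ a → a ≤ n → All (_< a) T →
    binom n a * (count T a * count [] (n ∸ a)) ≡ count T n + count (T ++ a ∷ []) n + count (T ++ suc a ∷ []) n
  count-split n a T 1≤a a≤n T<a = begin
      binom n a * (count T a * count [] (n ∸ a))
    ≡⟨ sym (splitting n a a≤n (indicator T) (indicator []) (PB-invariant _ T) (PB-invariant _ [])) ⟩
      sumL (Bᴵ n) (λ w → indicator T (take a w) * indicator [] (drop a w))
    ≡⟨ sumL-cong (Bᴵ n) (All.map (λ {w} lw → per-word w lw) (Bᴵ-length n)) ⟩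
      sumL (Bᴵ n) (λ w → indicator T w + indicator (T ++ a ∷ []) w + indicator (T ++ suc a ∷ []) w)
    ≡⟨ sumL-+ (Bᴵ n) _ _ ⟩
      sumL (Bᴵ n) (λ w → indicator T w + indicator (T ++ a ∷ []) w) + count (T ++ suc a ∷ []) n
    ≡⟨ cong (_+ count (T ++ suc a ∷ []) n) (sumL-+ (Bᴵ n) _ _) ⟩
      count T n + count (T ++ a ∷ []) n + count (T ++ suc a ∷ []) n ∎
    where
    open ≡-Reasoning
    indicator : List ℕ → List ℤ → ℕ
    indicator U w = 𝟙 (PB w ≟L U)
    per-word : ∀ w → length w ≡ n → indicator T (take a w) * indicator [] (drop a w) ≡
       indicator T w + indicator (T ++ a ∷ []) w + indicator (T ++ suc a ∷ []) w
    per-word w lw = subst (λ z → indicator T (take a w) * indicator [] (drop a w) ≡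
                                 indicator T z + indicator (T ++ a ∷ []) z + indicator (T ++ suc a ∷ []) z)
      (LP.take++drop≡id a w)
      (subst (λ k → indicator T (take a w) * indicator [] (drop a w) ≡
                    indicator T (take a w ++ drop a w) + indicator (T ++ k ∷ []) (take a w ++ drop a w) + indicator (T ++ suc k ∷ []) (take a w ++ drop a w))
        |take|
        (peak-split (take a w) (drop a w) T (subst (1 ≤_) (sym |take|) 1≤a) (subst (λ k → All (_< k) T) (sym |take|) T<a)))
      where
      |take| : length (take a w) ≡ a
      |take| = trans (LP.length-take a w) (m≤n⇒m⊓n≡m (subst (a ≤_) (sym lw) a≤n))

module PaddedLists where

  open import Data.Nat using (ℕ; suc; _⊔_; _≤_; s≤s)
  open import Data.Nat.Properties using (+-comm)
  open import Data.List using (List; []; _∷_; _++_; map; length)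
  import Data.List.Properties as LP
  open import Data.Product using (Σ; _×_; _,_)
  open import Relation.Binary.PropositionalEquality

  module Padded {A : Set} (_⊕_ : A → A → A) where

    add : List A → List A → List A
    add [] q = q
    add (x ∷ p) [] = x ∷ p
    add (x ∷ p) (y ∷ q) = (x ⊕ y) ∷ add p q

    length-add : ∀ p q → length (add p q) ≡ length p ⊔ length q
    length-add [] q = refl
    length-add (x ∷ p) [] = refl
    length-add (x ∷ p) (y ∷ q) = cong suc (length-add p q)

    HasTop : List A → ℕ → A → Set
    HasTop p d c = Σ (List A) λ xs → p ≡ xs ++ c ∷ [] × length xs ≡ d

    HasTop-length : ∀ {p d c} → HasTop p d c → length p ≡ suc d
    HasTop-length (xs , refl , refl) = trans (LP.length-++ xs) (+-comm (length xs) 1)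

    HasTop-add-left : ∀ {p d c} → HasTop p d c → ∀ q → length q ≤ d → HasTop (add p q) d c
    HasTop-add-left ([] , refl , refl) [] _ = [] , refl , refl
    HasTop-add-left (x ∷ xs , refl , refl) [] _ = (x ∷ xs) , refl , refl
    HasTop-add-left (x ∷ xs , refl , refl) (y ∷ q) (s≤s q≤) with HasTop-add-left (xs , refl , refl) q q≤
    ... | ys , e , l = ((x ⊕ y) ∷ ys) , cong ((x ⊕ y) ∷_) e , cong suc l

    HasTop-add-right : ∀ {q d c} p → length p ≤ d → HasTop q d c → HasTop (add p q) d c
    HasTop-add-right [] _ t = t
    HasTop-add-right (x ∷ p) (s≤s p≤) (y ∷ xs , refl , refl) with HasTop-add-right p p≤ (xs , refl , refl)
    ... | ys , e , l = ((x ⊕ y) ∷ ys) , cong ((x ⊕ y) ∷_) e , cong suc l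

    HasTop-map : ∀ {p d c} (f : A → A) → HasTop p d c → HasTop (map f p) d (f c)
    HasTop-map f (xs , refl , refl) = map f xs , LP.map-++ f xs _ , LP.length-map f xs

module Recursion where

  open import Defs
  open Sums
  open Peaks using (Gap; ValidPeakSet)
  open SignedPerms using (count)
  open Peakless using (peakless-count)
  open PeakCounts
  open PaddedLists
  open import Data.Nat as ℕ using (ℕ; zero; suc; _∸_; _^_; _≤_; _<_; z≤n; s≤s)
  open import Data.Nat.Properties as ℕP using (≤-refl; ≤-pred; <⇒≤; <-≤-trans; <-trans; ≤-trans)
  open import Data.Integer using (ℤ; +_; _+_; _*_; -_; _-_)
  import Data.Integer.Properties as ℤP
  open import Data.List using (List; []; _∷_; _++_; map; length; reverse)
  import Data.List.Properties as LP
  open import Data.List.Relation.Unary.All as All using (All; []; _∷_)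
  import Data.List.Relation.Unary.All.Properties as AllP
  open import Data.List.Relation.Unary.AllPairs using (AllPairs; []; _∷_; allPairs?)
  open import Data.List.Relation.Unary.Any.Properties using (reverse⁺)
  open import Data.Product using (_×_; _,_; proj₁; proj₂)
  open import Data.Sum using (inj₁; inj₂)
  open import Data.Empty using (⊥-elim)
  open import Relation.Nullary using (Dec; yes; no; ¬_; _×-dec_)
  open import Relation.Binary.PropositionalEquality
  open import Data.Nat.Solver using () renaming (module +-*-Solver to ℕ-Solver)
  open import Data.Integer.Solver using (module +-*-Solver)
  open +-*-Solver using (solve; _:+_; _:*_; _:-_; :-_; _:=_; con)

  module ZL = Padded _+_

  -- Integer coefficient lists read in the binomial basis:
  -- evalBinomFrom j (c₀ ∷ c₁ ∷ …) n = Σ_i c_i · C(n, i+j).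
  evalBinomFrom : ℕ → List ℤ → ℕ → ℤ
  evalBinomFrom j [] n = + 0
  evalBinomFrom j (c ∷ cs) n = c * + binom n j + evalBinomFrom (suc j) cs n

  evalBinom : List ℤ → ℕ → ℤ
  evalBinom cs n = evalBinomFrom 0 cs n

  evalBinom-add : ∀ j p q n → evalBinomFrom j (ZL.add p q) n ≡ evalBinomFrom j p n + evalBinomFrom j q n
  evalBinom-add j [] q n = sym (ℤP.+-identityˡ _)
  evalBinom-add j (x ∷ p) [] n = sym (ℤP.+-identityʳ _)
  evalBinom-add j (x ∷ p) (y ∷ q) n rewrite evalBinom-add (suc j) p q n =
    solve 5 (λ x y k a b → (x :+ y) :* k :+ (a :+ b) := (x :* k :+ a) :+ (y :* k :+ b)) refl
      x y (+ binom n j) (evalBinomFrom (suc j) p n) (evalBinomFrom (suc j) q n)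

  evalBinom-scale : ∀ j c p n → evalBinomFrom j (map (c *_) p) n ≡ c * evalBinomFrom j p n
  evalBinom-scale j c [] n = sym (ℤP.*-zeroʳ c)
  evalBinom-scale j c (x ∷ p) n rewrite evalBinom-scale (suc j) c p n =
    solve 4 (λ c x k a → (c :* x) :* k :+ c :* a := c :* (x :* k :+ a)) refl c x (+ binom n j) (evalBinomFrom (suc j) p n)

  single : ℤ → ℕ → List ℤ
  single c zero = c ∷ []
  single c (suc d) = + 0 ∷ single c d

  evalBinom-single : ∀ j c d n → evalBinomFrom j (single c d) n ≡ c * + binom n (d ℕ.+ j)
  evalBinom-single j c zero n = ℤP.+-identityʳ _
  evalBinom-single j c (suc d) n rewrite evalBinom-single (suc j) c d n | ℕP.+-suc d j = ℤP.+-identityˡ _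

  single-top : ∀ c d → ZL.HasTop (single c d) d c
  single-top c zero = [] , refl , refl
  single-top c (suc d) with single-top c d
  ... | xs , e , l = (+ 0 ∷ xs) , cong (+ 0 ∷_) e , cong suc l

  validPeakSet? : ∀ S → Dec (ValidPeakSet S)
  validPeakSet? S = All.all? (λ p → 2 ℕ.≤? p) S ×-dec allPairs? (λ p q → suc p ℕ.<? q) S

  keepIf : ∀ {P : Set} → Dec P → List ℤ → List ℤ
  keepIf (yes _) x = x
  keepIf (no _) _ = []

  -- Largest peak of a set listed in decreasing order (0 for ∅), and the bound
  -- "largest peak, or 1 for ∅" on the number of coefficients.
  top : List ℕ → ℕ
  top [] = 0
  top (m ∷ _) = m

  top⁺ : List ℕ → ℕ
  top⁺ [] = 1
  top⁺ (m ∷ _) = m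

  -- The binomial-basis coefficients of p_B(S, ·)·2^{|S|+1}, for S = reverse R
  -- (R lists S in decreasing order); k ≥ max S is fuel.
  mutual
    coeffs : ℕ → List ℕ → List ℤ
    coeffs k R = keepIf (validPeakSet? (reverse R)) (coeffs-step k R)

    coeffs-step : ℕ → List ℕ → List ℤ
    coeffs-step k [] = + 1 ∷ []
    coeffs-step zero (m ∷ R₁) = []
    coeffs-step (suc k) (m ∷ R₁) = ZL.add (single (evalBinom (coeffs k R₁) (m ∸ 1)) (m ∸ 1)) (correction k (m ∸ 1) R₁)

    correction : ℕ → ℕ → List ℕ → List ℤ
    correction k a R₁ = map (- + 1 *_) (ZL.add (map (+ 2 *_) (coeffs k R₁)) (coeffs k (a ∷ R₁)))

  coeffs-valid : ∀ k R → ValidPeakSet (reverse R) → coeffs k R ≡ coeffs-step k R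
  coeffs-valid k R v with validPeakSet? (reverse R)
  ... | yes _ = refl
  ... | no ¬v = ⊥-elim (¬v v)

  coeffs-invalid : ∀ k R → ¬ ValidPeakSet (reverse R) → coeffs k R ≡ []
  coeffs-invalid k R ¬v with validPeakSet? (reverse R)
  ... | yes v = ⊥-elim (¬v v)
  ... | no _ = refl

  private
    ValidPeakSet-snoc : ∀ T m → ValidPeakSet (T ++ m ∷ []) → ValidPeakSet T × 2 ≤ m × All (λ p → Gap p m) T
    ValidPeakSet-snoc T m (2≤ , gaps) = (AllP.++⁻ˡ T 2≤ , proj₁ (split T gaps)) , All.head (AllP.++⁻ʳ T 2≤) , proj₂ (split T gaps)
      where
      split : ∀ T → AllPairs Gap (T ++ m ∷ []) → AllPairs Gap T × All (λ p → Gap p m) T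
      split [] _ = [] , []
      split (t ∷ T) (g ∷ gs) = (AllP.++⁻ˡ T g ∷ proj₁ (split T gs)) , (All.head (AllP.++⁻ʳ T g) ∷ proj₂ (split T gs))

  record LastPeak (m : ℕ) (R₁ : List ℕ) : Set where
    field
      a : ℕ
      a+1≡m : suc a ≡ m
      1≤a : 1 ≤ a
      rest-valid : ValidPeakSet (reverse R₁)
      rest-below : All (_< a) (reverse R₁)
      top-below : top R₁ < a

  lastPeak : ∀ m R₁ → ValidPeakSet (reverse (m ∷ R₁)) → LastPeak m R₁
  lastPeak m R₁ v = record
    { a = m ∸ 1 ; a+1≡m = a+1≡m ; 1≤a = 1≤a ; rest-valid = proj₁ parts ; rest-below = rest-below
    ; top-below = top-below R₁ (All.tabulate (λ p∈ → All.lookup rest-below (reverse⁺ p∈))) }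
    where
    parts : ValidPeakSet (reverse R₁) × 2 ≤ m × All (λ p → Gap p m) (reverse R₁)
    parts = ValidPeakSet-snoc (reverse R₁) m (subst ValidPeakSet (LP.unfold-reverse m R₁) v)
    2≤m : 2 ≤ m
    2≤m = proj₁ (proj₂ parts)
    a+1≡m : suc (m ∸ 1) ≡ m
    a+1≡m = ℕP.suc-pred m {{ℕ.>-nonZero (<-≤-trans (s≤s z≤n) 2≤m)}}
    1≤a : 1 ≤ m ∸ 1
    1≤a = ≤-pred (subst (2 ≤_) (sym a+1≡m) 2≤m)
    rest-below : All (_< m ∸ 1) (reverse R₁)
    rest-below = All.map (λ {p} g → ≤-pred (subst (suc (suc p) ≤_) (sym a+1≡m) g)) (proj₂ (proj₂ parts))
    top-below : ∀ R₁ → All (_< m ∸ 1) R₁ → top R₁ < m ∸ 1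
    top-below [] _ = 1≤a
    top-below (p ∷ _) (p< ∷ _) = p<

  pow4 : ℕ → ℕ
  pow4 n = 2 ^ n ℕ.* 2 ^ n

  pow4-+ : ∀ x y → pow4 x ℕ.* pow4 y ≡ pow4 (x ℕ.+ y)
  pow4-+ x y rewrite ℕP.^-distribˡ-+-* 2 x y = regroup (2 ^ x) (2 ^ y)
    where
    open ℕ-Solver using () renaming (solve to solveℕ; _:*_ to _⊛_; _:=_ to _≐_)
    regroup : ∀ p q → (p ℕ.* p) ℕ.* (q ℕ.* q) ≡ (p ℕ.* q) ℕ.* (p ℕ.* q)
    regroup = solveℕ 2 (λ p q → (p ⊛ p) ⊛ (q ⊛ q) ≐ (p ⊛ q) ⊛ (p ⊛ q)) refl

  peakless-pow4 : ∀ j → + count [] (suc j) * + 2 ≡ + pow4 (suc j)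
  peakless-pow4 j = trans (sym (ℤP.pos-* (count [] (suc j)) 2)) (cong +_ (trans (cong (ℕ._* 2) (peakless-count j)) (regroup (2 ^ j))))
    where
    open ℕ-Solver using () renaming (solve to solveℕ; _:*_ to _⊛_; _:=_ to _≐_; con to conℕ)
    regroup : ∀ q → (2 ℕ.* (q ℕ.* q)) ℕ.* 2 ≡ (2 ℕ.* q) ℕ.* (2 ℕ.* q)
    regroup = solveℕ 1 (λ q → (conℕ 2 ⊛ (q ⊛ q)) ⊛ conℕ 2 ≐ (conℕ 2 ⊛ q) ⊛ (conℕ 2 ⊛ q)) refl

  recursion-algebra : ∀ (X A B C K e P c Fa Fr Fn vR vS : ℤ) →
    K * (C * e) ≡ A + B + X → C * P ≡ c * Fa → e * + 2 ≡ Fr → Fa * Fr ≡ Fn →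
    A * P ≡ vR * Fn → B * (+ 2 * P) ≡ vS * Fn →
    X * (+ 2 * P) ≡ (c * K + (- + 1) * (+ 2 * vR + vS)) * Fn
  recursion-algebra X A B C K e P c Fa Fr Fn vR vS split hC he hF hA hB = begin
      X * (+ 2 * P)
    ≡⟨ solve 4 (λ X A B P → X :* (con (+ 2) :* P) := ((A :+ B :+ X) :- A :- B) :* (con (+ 2) :* P)) refl X A B P ⟩
      ((A + B + X) - A - B) * (+ 2 * P)
    ≡⟨ cong (λ z → (z - A - B) * (+ 2 * P)) (sym split) ⟩
      (K * (C * e) - A - B) * (+ 2 * P)
    ≡⟨ solve 6 (λ K C e A B P → (K :* (C :* e) :- A :- B) :* (con (+ 2) :* P) :=
                                K :* ((C :* P) :* (e :* con (+ 2))) :- con (+ 2) :* (A :* P) :- B :* (con (+ 2) :* P)) refl K C e A B P ⟩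
      K * ((C * P) * (e * + 2)) - + 2 * (A * P) - B * (+ 2 * P)
    ≡⟨ cong₂ (λ u v → K * u - + 2 * v - B * (+ 2 * P)) (cong₂ _*_ hC he) hA ⟩
      K * ((c * Fa) * Fr) - + 2 * (vR * Fn) - B * (+ 2 * P)
    ≡⟨ cong (λ z → K * ((c * Fa) * Fr) - + 2 * (vR * Fn) - z) hB ⟩
      K * ((c * Fa) * Fr) - + 2 * (vR * Fn) - vS * Fn
    ≡⟨ cong (λ z → z - + 2 * (vR * Fn) - vS * Fn) (solve 4 (λ K c Fa Fr → K :* ((c :* Fa) :* Fr) := (K :* c) :* (Fa :* Fr)) refl K c Fa Fr) ⟩
      (K * c) * (Fa * Fr) - + 2 * (vR * Fn) - vS * Fn
    ≡⟨ cong (λ z → (K * c) * z - + 2 * (vR * Fn) - vS * Fn) hF ⟩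
      (K * c) * Fn - + 2 * (vR * Fn) - vS * Fn
    ≡⟨ solve 5 (λ K c vR vS Fn → (K :* c) :* Fn :- con (+ 2) :* (vR :* Fn) :- vS :* Fn :=
                                 (c :* K :+ (:- con (+ 1)) :* (con (+ 2) :* vR :+ vS)) :* Fn) refl K c vR vS Fn ⟩
      (c * K + (- + 1) * (+ 2 * vR + vS)) * Fn ∎
    where open ≡-Reasoning

  evalBinom-coeffs-step : ∀ k m R₁ n → ValidPeakSet (reverse (m ∷ R₁)) →
    evalBinom (coeffs (suc k) (m ∷ R₁)) n ≡
    evalBinom (coeffs k R₁) (m ∸ 1) * + binom n (m ∸ 1) + (- + 1) * (+ 2 * evalBinom (coeffs k R₁) n + evalBinom (coeffs k ((m ∸ 1) ∷ R₁)) n)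
  evalBinom-coeffs-step k m R₁ n v = begin
      evalBinom (coeffs (suc k) (m ∷ R₁)) n
    ≡⟨ cong (λ z → evalBinom z n) (coeffs-valid (suc k) (m ∷ R₁) v) ⟩
      evalBinom (ZL.add (single c a) (correction k a R₁)) n
    ≡⟨ evalBinom-add 0 (single c a) (correction k a R₁) n ⟩
      evalBinom (single c a) n + evalBinom (correction k a R₁) n
    ≡⟨ cong₂ _+_ (trans (evalBinom-single 0 c a n) (cong (λ z → c * + binom n z) (ℕP.+-identityʳ a)))
                 (trans (evalBinom-scale 0 (- + 1) (ZL.add (map (+ 2 *_) (coeffs k R₁)) (coeffs k (a ∷ R₁))) n)
                        (cong ((- + 1) *_) (trans (evalBinom-add 0 (map (+ 2 *_) (coeffs k R₁)) (coeffs k (a ∷ R₁)) n)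
                                                  (cong (_+ evalBinom (coeffs k (a ∷ R₁)) n) (evalBinom-scale 0 (+ 2) (coeffs k R₁) n))))) ⟩
      c * + binom n a + (- + 1) * (+ 2 * evalBinom (coeffs k R₁) n + evalBinom (coeffs k (a ∷ R₁)) n) ∎
    where
    open ≡-Reasoning
    a = m ∸ 1
    c = evalBinom (coeffs k R₁) a

  private
    ∸-pred : ∀ n a → suc a ≤ n → n ∸ a ≡ suc (n ∸ suc a)
    ∸-pred (suc n) zero _ = refl
    ∸-pred (suc n) (suc a) (s≤s a<n) = ∸-pred n a a<n

  -- By induction on S, removing its largest element m = a+1 and using
  -- count-split at a, where #P(S∖{m}, a) and #P(∅, n-a) are known.
  count-formula : ∀ k R → top R ≤ k → ValidPeakSet (reverse R) → ∀ n → top R < n →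
    + count (reverse R) n * + (2 ^ suc (length R)) ≡ evalBinom (coeffs k R) n * + pow4 n
  count-formula k [] _ v (suc n) _ = trans (peakless-pow4 n)
    (sym (trans (cong (λ z → evalBinom z (suc n) * + pow4 (suc n)) (coeffs-valid k [] v)) (ℤP.*-identityˡ _)))
  count-formula zero (m ∷ R₁) m≤0 v n _ with subst (_≤ 0) (sym (LastPeak.a+1≡m (lastPeak m R₁ v))) m≤0
  ... | ()
  count-formula (suc k) (m ∷ R₁) m≤ v n m<n =
    trans (cong (λ z → X * z) (ℤP.pos-* 2 (2 ^ suc s)))
      (trans (recursion-algebra X A Y C K e P c Fa Fr Fn vR vS split hC he hF hA hY)
        (cong (_* Fn) (sym (evalBinom-coeffs-step k m R₁ n v))))
    where
    open LastPeak (lastPeak m R₁ v)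
    T = reverse R₁
    s = length R₁
    a≤k : a ≤ k
    a≤k = ≤-pred (subst (_≤ suc k) (sym a+1≡m) m≤)
    a<n : a < n
    a<n = subst (_≤ n) (sym a+1≡m) (<⇒≤ m<n)
    R₁≤k : top R₁ ≤ k
    R₁≤k = <⇒≤ (<-≤-trans top-below a≤k)
    -- X, A, Y: the counts of S, T and T∪{a} at n; C: of T at a; e: of ∅ at n-a.
    X = + count (reverse (m ∷ R₁)) n
    A = + count T n
    Y = + count (T ++ a ∷ []) n
    C = + count T a
    K = + binom n a
    e = + count [] (n ∸ a)
    P = + (2 ^ suc s)
    c = evalBinom (coeffs k R₁) a
    Fa = + pow4 a
    Fr = + pow4 (n ∸ a)
    Fn = + pow4 n
    vR = evalBinom (coeffs k R₁) n
    vS = evalBinom (coeffs k (a ∷ R₁)) n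
    split : K * (C * e) ≡ A + Y + X
    split = begin
        K * (C * e)
      ≡⟨ cong (K *_) (sym (ℤP.pos-* (count T a) _)) ⟩
        K * + (count T a ℕ.* count [] (n ∸ a))
      ≡⟨ sym (ℤP.pos-* (binom n a) _) ⟩
        + (binom n a ℕ.* (count T a ℕ.* count [] (n ∸ a)))
      ≡⟨ cong +_ (count-split n a T 1≤a (<⇒≤ a<n) rest-below) ⟩
        + (count T n ℕ.+ count (T ++ a ∷ []) n ℕ.+ count (T ++ suc a ∷ []) n)
      ≡⟨ cong (λ U → + (count T n ℕ.+ count (T ++ a ∷ []) n ℕ.+ count U n))
              (trans (cong (λ q → T ++ q ∷ []) a+1≡m) (sym (LP.unfold-reverse m R₁))) ⟩
        + (count T n ℕ.+ count (T ++ a ∷ []) n ℕ.+ count (reverse (m ∷ R₁)) n)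
      ≡⟨ trans (ℤP.pos-+ (count T n ℕ.+ count (T ++ a ∷ []) n) _) (cong (_+ X) (ℤP.pos-+ (count T n) _)) ⟩
        A + Y + X ∎
      where open ≡-Reasoning
    hC : C * P ≡ c * Fa
    hC = count-formula k R₁ R₁≤k rest-valid a top-below
    hA : A * P ≡ vR * Fn
    hA = count-formula k R₁ R₁≤k rest-valid n (<-trans top-below a<n)
    hY : Y * (+ 2 * P) ≡ vS * Fn
    hY with validPeakSet? (T ++ a ∷ [])
    ... | yes v' = trans (cong (λ U → + count U n * (+ 2 * P)) (sym (LP.unfold-reverse a R₁)))
                     (trans (cong (+ count (reverse (a ∷ R₁)) n *_) (sym (ℤP.pos-* 2 (2 ^ suc s))))
                       (count-formula k (a ∷ R₁) a≤k (subst ValidPeakSet (sym (LP.unfold-reverse a R₁)) v') n a<n))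
    ... | no ¬v' = trans (cong (λ z → + z * (+ 2 * P)) (count-invalid (T ++ a ∷ []) n ¬v'))
                     (sym (cong (λ z → evalBinom z n * Fn) (coeffs-invalid k (a ∷ R₁) (λ v' → ¬v' (subst ValidPeakSet (LP.unfold-reverse a R₁) v')))))
    he : e * + 2 ≡ Fr
    he = subst (λ j → + count [] j * + 2 ≡ + pow4 j) (sym n∸a) (peakless-pow4 (n ∸ m))
      where
      n∸a : n ∸ a ≡ suc (n ∸ m)
      n∸a = trans (∸-pred n a a<n) (cong (λ z → suc (n ∸ z)) a+1≡m)
    hF : Fa * Fr ≡ Fn
    hF = trans (sym (ℤP.pos-* (pow4 a) (pow4 (n ∸ a)))) (cong +_ (trans (pow4-+ a (n ∸ a)) (cong pow4 (ℕP.m+[n∸m]≡n (<⇒≤ a<n)))))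

  private
    top⁺-below : ∀ a R₁ → 1 ≤ a → top R₁ < a → top⁺ R₁ ≤ a
    top⁺-below a [] 1≤a _ = 1≤a
    top⁺-below a (p ∷ _) _ p<a = <⇒≤ p<a

  mutual
    length-coeffs : ∀ k R → top R ≤ k → length (coeffs k R) ≤ top⁺ R
    length-coeffs k R R≤k with validPeakSet? (reverse R)
    ... | no _ = z≤n
    length-coeffs k [] R≤k | yes _ = ≤-refl
    length-coeffs zero (m ∷ R₁) R≤k | yes _ = z≤n
    length-coeffs (suc k) (m ∷ R₁) m≤ | yes v =
      subst (_≤ m) (sym (ZL.length-add (single c a) (correction k a R₁)))
        (ℕP.⊔-lub (ℕP.≤-reflexive (trans (ZL.HasTop-length (single-top c a)) a+1≡m))
                  (≤-trans (length-correction k m R₁ m≤ v) (ℕP.m∸n≤m m 1)))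
      where
      open LastPeak (lastPeak m R₁ v)
      c = evalBinom (coeffs k R₁) a

    -- The correction term has degree below m - 1, so it cannot affect the top coefficient.
    length-correction : ∀ k m R₁ → m ≤ suc k → ValidPeakSet (reverse (m ∷ R₁)) → length (correction k (m ∸ 1) R₁) ≤ m ∸ 1
    length-correction k m R₁ m≤ v =
      subst (_≤ a) (sym (trans (LP.length-map (- + 1 *_) (ZL.add doubled (coeffs k (a ∷ R₁)))) (ZL.length-add doubled (coeffs k (a ∷ R₁)))))
        (ℕP.⊔-lub (subst (_≤ a) (sym (LP.length-map (+ 2 *_) (coeffs k R₁)))
                           (≤-trans (length-coeffs k R₁ (<⇒≤ (<-≤-trans top-below a≤k))) (top⁺-below a R₁ 1≤a top-below)))
                  (length-coeffs k (a ∷ R₁) a≤k))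
      where
      open LastPeak (lastPeak m R₁ v)
      doubled = map (+ 2 *_) (coeffs k R₁)
      a≤k : a ≤ k
      a≤k = ≤-pred (subst (_≤ suc k) (sym a+1≡m) m≤)

  coeffs-top : ∀ k m R₁ → m ≤ suc k → ValidPeakSet (reverse (m ∷ R₁)) →
    ZL.HasTop (coeffs (suc k) (m ∷ R₁)) (m ∸ 1) (evalBinom (coeffs k R₁) (m ∸ 1))
  coeffs-top k m R₁ m≤ v = subst (λ z → ZL.HasTop z (m ∸ 1) (evalBinom (coeffs k R₁) (m ∸ 1))) (sym (coeffs-valid (suc k) (m ∷ R₁) v))
    (ZL.HasTop-add-left (single-top _ (m ∸ 1)) (correction k (m ∸ 1) R₁) (length-correction k m R₁ m≤ v))

  -- If S is admissible then this top coefficient is nonzero: were p_T(m-1) = 0,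
  -- then #P(T, m-1) = 0 and count-split would force #P(S, n₀) = 0.
  coeffs-top-nonzero : ∀ k m R₁ → m ≤ suc k → ValidPeakSet (reverse (m ∷ R₁)) → ∀ n₀ → m < n₀ →
    count (reverse (m ∷ R₁)) n₀ ≢ 0 → evalBinom (coeffs k R₁) (m ∸ 1) ≢ + 0
  coeffs-top-nonzero k m R₁ m≤ v n₀ m<n₀ S≢0 c≡0 = T≢0 T≡0
    where
    open LastPeak (lastPeak m R₁ v)
    T = reverse R₁
    a≤k : a ≤ k
    a≤k = ≤-pred (subst (_≤ suc k) (sym a+1≡m) m≤)
    a<n₀ : a < n₀
    a<n₀ = subst (_≤ n₀) (sym a+1≡m) (<⇒≤ m<n₀)
    T≢0 : count T a ≢ 0
    T≢0 e = S≢0 (trans (cong (λ U → count U n₀) (trans (LP.unfold-reverse m R₁) (cong (λ q → T ++ q ∷ []) (sym a+1≡m))))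
      (ℕP.m+n≡0⇒n≡0 (count T n₀ ℕ.+ count (T ++ a ∷ []) n₀)
        (trans (sym (count-split n₀ a T 1≤a (<⇒≤ a<n₀) rest-below))
               (trans (cong (λ q → binom n₀ a ℕ.* (q ℕ.* count [] (n₀ ∸ a))) e) (ℕP.*-zeroʳ (binom n₀ a))))))
    T≡0 : count T a ≡ 0
    T≡0 with ℕP.m*n≡0⇒m≡0∨n≡0 (count T a)
               (ℤP.+-injective (trans (ℤP.pos-* (count T a) _)
                 (trans (count-formula k R₁ (<⇒≤ (<-≤-trans top-below a≤k)) rest-valid a top-below) (cong (_* + pow4 a) c≡0))))
    ... | inj₁ e = e
    ... | inj₂ e with ℕP.m^n≡0⇒m≡0 2 (suc (length R₁)) e
    ...   | ()

module Polynomials where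

  open import Defs
  open Sums using (binom)
  open Recursion using (evalBinomFrom)
  open PaddedLists
  open import Data.Nat as ℕ using (ℕ; zero; suc; _≤_; z≤n; s≤s)
  import Data.Nat.Properties as ℕP
  open import Data.Nat.GCD using (gcd-zero)
  open import Data.Integer as ℤ using (ℤ; +_; -[1+_])
  import Data.Integer.Properties as ℤP
  open import Data.Rational as ℚ using (ℚ; _/_; ↥_; ↧_; ↧ₙ_; 0ℚ; 1ℚ; _+_; _*_; _-_; -_; 1/_)
  import Data.Rational.Properties as ℚP
  open import Data.List using (List; []; _∷_; _++_; map; length)
  import Data.List.Properties as LP
  open import Data.Product using (Σ; _,_; proj₂)
  open import Relation.Binary.PropositionalEquality
  open import Data.Rational.Solver using (module +-*-Solver)
  open +-*-Solver using (solve; _:+_; _:*_; _:-_; _:=_; con)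

  module QL = Padded _+_

  ι : ℤ → ℚ
  ι z = z / 1

  private
    ↥ι : ∀ a → ↥ ι a ≡ a
    ↥ι a = trans (sym (ℤP.*-identityʳ (↥ ι a))) (trans (cong (↥ ι a ℤ.*_) (sym (cong +_ (proj₂ gcd-zero ℤ.∣ a ∣)))) (ℚP.↥-/ a 1))

    ↧ₙι : ∀ a → ↧ₙ ι a ≡ 1
    ↧ₙι a = cong ℤ.∣_∣ (trans (sym (ℤP.*-identityʳ (↧ ι a))) (trans (cong (↧ ι a ℤ.*_) (sym (cong +_ (proj₂ gcd-zero ℤ.∣ a ∣)))) (ℚP.↧-/ a 1)))

    +-unfold : ∀ p q → p + q ≡ (↥ p ℤ.* ↧ q ℤ.+ ↥ q ℤ.* ↧ p) / (↧ₙ p ℕ.* ↧ₙ q)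
    +-unfold (ℚ.mkℚ _ _ _) (ℚ.mkℚ _ _ _) = refl

    *-unfold : ∀ p q → p * q ≡ (↥ p ℤ.* ↥ q) / (↧ₙ p ℕ.* ↧ₙ q)
    *-unfold (ℚ.mkℚ _ _ _) (ℚ.mkℚ _ _ _) = refl

    ↧ι : ∀ a → ↧ ι a ≡ + 1
    ↧ι a = cong +_ (↧ₙι a)

  ι-+ : ∀ a b → ι a + ι b ≡ ι (a ℤ.+ b)
  ι-+ a b = trans (+-unfold (ι a) (ι b)) (ℚP./-cong numerator (cong₂ ℕ._*_ (↧ₙι a) (↧ₙι b)))
    where
    numerator : ↥ ι a ℤ.* ↧ ι b ℤ.+ ↥ ι b ℤ.* ↧ ι a ≡ a ℤ.+ b
    numerator = trans (cong₂ ℤ._+_ (cong₂ ℤ._*_ (↥ι a) (↧ι b)) (cong₂ ℤ._*_ (↥ι b) (↧ι a)))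
                      (cong₂ ℤ._+_ (ℤP.*-identityʳ a) (ℤP.*-identityʳ b))

  ι-* : ∀ a b → ι a * ι b ≡ ι (a ℤ.* b)
  ι-* a b = trans (*-unfold (ι a) (ι b)) (ℚP./-cong (cong₂ ℤ._*_ (↥ι a) (↥ι b)) (cong₂ ℕ._*_ (↧ₙι a) (↧ₙι b)))

  ι-- : ∀ a b → ι (a ℤ.- b) ≡ ι a - ι b
  ι-- a b = trans (sym (ι-+ a (ℤ.- b))) (cong (λ y → ι a + y) ι-neg)
    where
    ι-neg : ι (ℤ.- b) ≡ - ι b
    ι-neg = trans (solve 2 (λ y x → y := (y :+ x) :- x) refl (ι (ℤ.- b)) (ι b))
      (trans (cong (_- ι b) (trans (ι-+ (ℤ.- b) b) (cong ι (ℤP.+-inverseˡ b))))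
        (solve 1 (λ x → con 0ℚ :- x := +-*-Solver.:-_ x) refl (ι b)))

  ι-nonzero : ∀ c → c ≢ + 0 → ι c ≢ 0ℚ
  ι-nonzero c c≢0 e = c≢0 (trans (sym (↥ι c)) (cong ↥_ e))

  ι-suc : ∀ k → ι (+ suc k) ≡ ι (+ k) + 1ℚ
  ι-suc k = sym (trans (ι-+ (+ k) (+ 1)) (cong (λ q → ι (+ q)) (ℕP.+-comm k 1)))

  eval-add : ∀ p q x → eval (QL.add p q) x ≡ eval p x + eval q x
  eval-add [] q x = sym (ℚP.+-identityˡ _)
  eval-add (a ∷ p) [] x = sym (ℚP.+-identityʳ _)
  eval-add (a ∷ p) (b ∷ q) x rewrite eval-add p q x =
    solve 5 (λ a b x u v → (a :+ b) :+ x :* (u :+ v) := (a :+ x :* u) :+ (b :+ x :* v)) refl a b x (eval p x) (eval q x)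

  eval-scale : ∀ c p x → eval (map (c *_) p) x ≡ c * eval p x
  eval-scale c [] x = sym (ℚP.*-zeroʳ c)
  eval-scale c (a ∷ p) x rewrite eval-scale c p x =
    solve 4 (λ c a x u → c :* a :+ x :* (c :* u) := c :* (a :+ x :* u)) refl c a x (eval p x)

  timesLinear : ℚ → List ℚ → List ℚ
  timesLinear j p = QL.add (0ℚ ∷ p) (map ((- j) *_) p)

  eval-timesLinear : ∀ j p x → eval (timesLinear j p) x ≡ (x - j) * eval p x
  eval-timesLinear j p x = trans (eval-add (0ℚ ∷ p) (map ((- j) *_) p) x)
    (trans (cong (λ y → eval (0ℚ ∷ p) x + y) (eval-scale (- j) p x))
      (solve 3 (λ x j u → (con 0ℚ :+ x :* u) :+ (+-*-Solver.:-_ j) :* u := (x :- j) :* u) refl x j (eval p x)))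

  private
    ι-suc-nonZero : ∀ k → ℚ.NonZero (ι (+ suc k))
    ι-suc-nonZero k = ℚ.≢-nonZero (ι-nonzero (+ suc k) (λ ()))

  recip : ℕ → ℚ
  recip k = (1/ ι (+ suc k)) {{ι-suc-nonZero k}}

  recip-inverse : ∀ k → recip k * ι (+ suc k) ≡ 1ℚ
  recip-inverse k = ℚP.*-inverseˡ (ι (+ suc k)) {{ι-suc-nonZero k}}

  binomPoly : ℕ → List ℚ
  binomPoly zero = 1ℚ ∷ []
  binomPoly (suc k) = map (recip k *_) (timesLinear (ι (+ k)) (binomPoly k))

  binomℚ : ℕ → ℚ → ℚ
  binomℚ k x = eval (binomPoly k) x

  binomℚ-zero : ∀ x → binomℚ 0 x ≡ 1ℚ
  binomℚ-zero x = solve 1 (λ x → con 1ℚ :+ x :* con 0ℚ := con 1ℚ) refl x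

  binomℚ-suc : ∀ k x → binomℚ (suc k) x ≡ recip k * ((x - ι (+ k)) * binomℚ k x)
  binomℚ-suc k x = trans (eval-scale (recip k) (timesLinear (ι (+ k)) (binomPoly k)) x)
    (cong (recip k *_) (eval-timesLinear (ι (+ k)) (binomPoly k) x))

  pascal : ∀ k x → binomℚ (suc k) (x + 1ℚ) ≡ binomℚ (suc k) x + binomℚ k x
  pascal zero x = begin
      binomℚ 1 (x + 1ℚ)
    ≡⟨ binomℚ-suc 0 (x + 1ℚ) ⟩
      recip 0 * ((x + 1ℚ - ι (+ 0)) * binomℚ 0 (x + 1ℚ))
    ≡⟨ cong (λ z → recip 0 * ((x + 1ℚ - ι (+ 0)) * z)) (trans (binomℚ-zero (x + 1ℚ)) (sym (binomℚ-zero x))) ⟩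
      recip 0 * ((x + 1ℚ - ι (+ 0)) * binomℚ 0 x)
    ≡⟨ solve 3 (λ r x e → r :* ((x :+ con 1ℚ :- con 0ℚ) :* e) := r :* ((x :- con 0ℚ) :* e) :+ (r :* con 1ℚ) :* e) refl (recip 0) x (binomℚ 0 x) ⟩
      recip 0 * ((x - ι (+ 0)) * binomℚ 0 x) + (recip 0 * 1ℚ) * binomℚ 0 x
    ≡⟨ cong (λ z → recip 0 * ((x - ι (+ 0)) * binomℚ 0 x) + z * binomℚ 0 x) (recip-inverse 0) ⟩
      recip 0 * ((x - ι (+ 0)) * binomℚ 0 x) + 1ℚ * binomℚ 0 x
    ≡⟨ cong₂ _+_ (sym (binomℚ-suc 0 x)) (ℚP.*-identityˡ _) ⟩
      binomℚ 1 x + binomℚ 0 x ∎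
    where open ≡-Reasoning
  pascal (suc k) x = begin
      binomℚ (suc (suc k)) (x + 1ℚ)
    ≡⟨ binomℚ-suc (suc k) (x + 1ℚ) ⟩
      r' * ((x + 1ℚ - ι (+ suc k)) * binomℚ (suc k) (x + 1ℚ))
    ≡⟨ cong₂ (λ u v → r' * ((x + 1ℚ - u) * v)) (ι-suc k) (trans (pascal k x) (cong (_+ E₀) (binomℚ-suc k x))) ⟩
      r' * ((x + 1ℚ - (t + 1ℚ)) * (E₁ + E₀))
    ≡⟨ solve 5 (λ r r' x t e → r' :* ((x :+ con 1ℚ :- (t :+ con 1ℚ)) :* (r :* ((x :- t) :* e) :+ e))
          := (r' :* ((x :- (t :+ con 1ℚ)) :* (r :* ((x :- t) :* e))) :+ r :* ((x :- t) :* e)) :+ ((x :- t) :* e) :* (r' :* (r :+ con 1ℚ) :- r))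
          refl r r' x t E₀ ⟩
      (r' * ((x - (t + 1ℚ)) * E₁) + E₁) + ((x - t) * E₀) * (r' * (r + 1ℚ) - r)
    ≡⟨ cong (λ z → (r' * ((x - (t + 1ℚ)) * E₁) + E₁) + ((x - t) * E₀) * z) recip-relation ⟩
      (r' * ((x - (t + 1ℚ)) * E₁) + E₁) + ((x - t) * E₀) * 0ℚ
    ≡⟨ solve 2 (λ a b → a :+ b :* con 0ℚ := a) refl _ ((x - t) * E₀) ⟩
      r' * ((x - (t + 1ℚ)) * E₁) + E₁
    ≡⟨ cong₂ (λ u v → r' * ((x - u) * v) + v) (sym (ι-suc k)) (sym (binomℚ-suc k x)) ⟩
      r' * ((x - ι (+ suc k)) * binomℚ (suc k) x) + binomℚ (suc k) x
    ≡⟨ cong (_+ binomℚ (suc k) x) (sym (binomℚ-suc (suc k) x)) ⟩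
      binomℚ (suc (suc k)) x + binomℚ (suc k) x ∎
    where
    open ≡-Reasoning
    t = ι (+ k)
    r = recip k
    r' = recip (suc k)
    E₀ = binomℚ k x
    E₁ = r * ((x - t) * E₀)
    recip-relation : r' * (r + 1ℚ) - r ≡ 0ℚ
    recip-relation = begin
        r' * (r + 1ℚ) - r
      ≡⟨ cong (λ z → r' * (r + z) - r) (sym (trans (cong (r *_) (sym (ι-suc k))) (recip-inverse k))) ⟩
        r' * (r + r * (t + 1ℚ)) - r
      ≡⟨ solve 3 (λ r r' t → r' :* (r :+ r :* (t :+ con 1ℚ)) :- r := r :* (r' :* (t :+ con 1ℚ :+ con 1ℚ)) :- r) refl r r' t ⟩
        r * (r' * (t + 1ℚ + 1ℚ)) - r
      ≡⟨ cong (λ z → r * z - r) (trans (cong (r' *_) (trans (cong (_+ 1ℚ) (sym (ι-suc k))) (sym (ι-suc (suc k))))) (recip-inverse (suc k))) ⟩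
        r * 1ℚ - r
      ≡⟨ solve 1 (λ r → r :* con 1ℚ :- r := con 0ℚ) refl r ⟩
        0ℚ ∎

  binomℚ-at-zero : ∀ k → binomℚ (suc k) (ι (+ 0)) ≡ 0ℚ
  binomℚ-at-zero zero = trans (binomℚ-suc 0 (ι (+ 0))) (solve 2 (λ r e → r :* ((con 0ℚ :- con 0ℚ) :* e) := con 0ℚ) refl (recip 0) (binomℚ 0 0ℚ))
  binomℚ-at-zero (suc k) = trans (binomℚ-suc (suc k) (ι (+ 0)))
    (trans (cong (λ z → recip (suc k) * ((ι (+ 0) - ι (+ suc k)) * z)) (binomℚ-at-zero k))
      (solve 2 (λ r t → r :* ((con 0ℚ :- t) :* con 0ℚ) := con 0ℚ) refl (recip (suc k)) (ι (+ suc k))))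

  binomℚ-ℕ : ∀ k n → binomℚ k (ι (+ n)) ≡ ι (+ binom n k)
  binomℚ-ℕ zero n = binomℚ-zero (ι (+ n))
  binomℚ-ℕ (suc k) zero = binomℚ-at-zero k
  binomℚ-ℕ (suc k) (suc n) = begin
      binomℚ (suc k) (ι (+ suc n))
    ≡⟨ cong (binomℚ (suc k)) (ι-suc n) ⟩
      binomℚ (suc k) (ι (+ n) + 1ℚ)
    ≡⟨ pascal k (ι (+ n)) ⟩
      binomℚ (suc k) (ι (+ n)) + binomℚ k (ι (+ n))
    ≡⟨ cong₂ _+_ (binomℚ-ℕ (suc k) n) (binomℚ-ℕ k n) ⟩
      ι (+ binom n (suc k)) + ι (+ binom n k)
    ≡⟨ ι-+ (+ binom n (suc k)) (+ binom n k) ⟩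
      ι (+ binom n (suc k) ℤ.+ + binom n k)
    ≡⟨ cong ι (trans (sym (ℤP.pos-+ (binom n (suc k)) (binom n k))) (cong +_ (ℕP.+-comm (binom n (suc k)) (binom n k)))) ⟩
      ι (+ binom (suc n) (suc k)) ∎
    where open ≡-Reasoning

  -- Binomial polynomials are integer valued at all integers: at negative
  -- arguments use Pascal's rule backwards, C(x, k+1) = C(x+1, k+1) - C(x, k).
  mutual
    binomℚ-integer : ∀ k z → Σ ℤ λ m → binomℚ k (ι z) ≡ ι m
    binomℚ-integer zero z = + 1 , binomℚ-zero (ι z)
    binomℚ-integer (suc k) (+ n) = + binom n (suc k) , binomℚ-ℕ (suc k) n
    binomℚ-integer (suc k) -[1+ n ] = binomℚ-negative k n

    binomℚ-negative : ∀ k n → Σ ℤ λ m → binomℚ (suc k) (ι -[1+ n ]) ≡ ι m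
    binomℚ-negative k n with binomℚ-next k n | binomℚ-integer k -[1+ n ]
    ... | (m₁ , e₁) | (m₂ , e₂) = (m₁ ℤ.- m₂) , (begin
        binomℚ (suc k) x
      ≡⟨ solve 2 (λ a b → a := (a :+ b) :- b) refl (binomℚ (suc k) x) (binomℚ k x) ⟩
        (binomℚ (suc k) x + binomℚ k x) - binomℚ k x
      ≡⟨ cong (_- binomℚ k x) (sym (pascal k x)) ⟩
        binomℚ (suc k) (x + 1ℚ) - binomℚ k x
      ≡⟨ cong₂ _-_ (trans (cong (binomℚ (suc k)) (ι-+ -[1+ n ] (+ 1))) e₁) e₂ ⟩
        ι m₁ - ι m₂
      ≡⟨ sym (ι-- m₁ m₂) ⟩
        ι (m₁ ℤ.- m₂) ∎)
      where
      open ≡-Reasoning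
      x = ι -[1+ n ]

    binomℚ-next : ∀ k n → Σ ℤ λ m → binomℚ (suc k) (ι (-[1+ n ] ℤ.+ + 1)) ≡ ι m
    binomℚ-next k zero = + 0 , binomℚ-at-zero k
    binomℚ-next k (suc n) = binomℚ-negative k n

  fromBinomialFrom : ℕ → List ℤ → List ℚ
  fromBinomialFrom j [] = []
  fromBinomialFrom j (c ∷ cs) = QL.add (map (ι c *_) (binomPoly j)) (fromBinomialFrom (suc j) cs)

  fromBinomial : List ℤ → List ℚ
  fromBinomial cs = fromBinomialFrom 0 cs

  eval-fromBinomial : ∀ j cs n → eval (fromBinomialFrom j cs) (ι (+ n)) ≡ ι (evalBinomFrom j cs n)
  eval-fromBinomial j [] n = refl
  eval-fromBinomial j (c ∷ cs) n = begin
      eval (QL.add (map (ι c *_) (binomPoly j)) (fromBinomialFrom (suc j) cs)) (ι (+ n))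
    ≡⟨ eval-add (map (ι c *_) (binomPoly j)) (fromBinomialFrom (suc j) cs) (ι (+ n)) ⟩
      eval (map (ι c *_) (binomPoly j)) (ι (+ n)) + eval (fromBinomialFrom (suc j) cs) (ι (+ n))
    ≡⟨ cong₂ _+_ (trans (eval-scale (ι c) (binomPoly j) (ι (+ n))) (cong (ι c *_) (binomℚ-ℕ j n))) (eval-fromBinomial (suc j) cs n) ⟩
      ι c * ι (+ binom n j) + ι (evalBinomFrom (suc j) cs n)
    ≡⟨ cong (_+ ι (evalBinomFrom (suc j) cs n)) (ι-* c (+ binom n j)) ⟩
      ι (c ℤ.* + binom n j) + ι (evalBinomFrom (suc j) cs n)
    ≡⟨ ι-+ (c ℤ.* + binom n j) (evalBinomFrom (suc j) cs n) ⟩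
      ι (evalBinomFrom j (c ∷ cs) n) ∎
    where open ≡-Reasoning

  fromBinomial-integer : ∀ j cs z → Σ ℤ λ m → eval (fromBinomialFrom j cs) (ι z) ≡ ι m
  fromBinomial-integer j [] z = + 0 , refl
  fromBinomial-integer j (c ∷ cs) z with binomℚ-integer j z | fromBinomial-integer (suc j) cs z
  ... | (m₁ , e₁) | (m₂ , e₂) = (c ℤ.* m₁ ℤ.+ m₂) ,
    trans (eval-add (map (ι c *_) (binomPoly j)) (fromBinomialFrom (suc j) cs) (ι z))
      (trans (cong₂ _+_ (trans (eval-scale (ι c) (binomPoly j) (ι z)) (trans (cong (ι c *_) e₁) (ι-* c m₁))) e₂)
        (ι-+ (c ℤ.* m₁) m₂))

  leading : ℕ → ℚ
  leading zero = 1ℚ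
  leading (suc k) = recip k * leading k

  HasTop-timesLinear : ∀ {p d c} j → QL.HasTop p d c → QL.HasTop (timesLinear j p) (suc d) c
  HasTop-timesLinear {p} j t@(xs , refl , refl) = QL.HasTop-add-left ((0ℚ ∷ xs) , refl , refl) (map ((- j) *_) p)
    (ℕP.≤-reflexive (trans (LP.length-map ((- j) *_) p) (QL.HasTop-length t)))

  HasTop-binomPoly : ∀ k → QL.HasTop (binomPoly k) k (leading k)
  HasTop-binomPoly zero = [] , refl , refl
  HasTop-binomPoly (suc k) = QL.HasTop-map (recip k *_) (HasTop-timesLinear (ι (+ k)) (HasTop-binomPoly k))

  *-nonzero : ∀ a b → a ≢ 0ℚ → b ≢ 0ℚ → a * b ≢ 0ℚ
  *-nonzero a b a≢0 b≢0 e = b≢0 (begin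
      b                ≡⟨ sym (ℚP.*-identityˡ b) ⟩
      1ℚ * b           ≡⟨ cong (_* b) (sym (ℚP.*-inverseˡ a)) ⟩
      (a⁻¹ * a) * b    ≡⟨ ℚP.*-assoc a⁻¹ a b ⟩
      a⁻¹ * (a * b)    ≡⟨ cong (a⁻¹ *_) e ⟩
      a⁻¹ * 0ℚ         ≡⟨ ℚP.*-zeroʳ a⁻¹ ⟩
      0ℚ               ∎)
    where
    open ≡-Reasoning
    instance _ = ℚ.≢-nonZero a≢0
    a⁻¹ = 1/ a

  leading-nonzero : ∀ k → leading k ≢ 0ℚ
  leading-nonzero zero = ℚP.1≢0
  leading-nonzero (suc k) = *-nonzero (recip k) (leading k) recip-nonzero (leading-nonzero k)
    where
    recip-nonzero : recip k ≢ 0ℚ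
    recip-nonzero e = ℚP.1≢0 (trans (sym (recip-inverse k)) (trans (cong (_* ι (+ suc k)) e) (ℚP.*-zeroˡ (ι (+ suc k)))))

  HasTop-fromBinomial : ∀ j xs c → QL.HasTop (fromBinomialFrom j (xs ++ c ∷ [])) (j ℕ.+ length xs) (ι c * leading (j ℕ.+ length xs))
  HasTop-fromBinomial j [] c = subst (λ d → QL.HasTop (QL.add (map (ι c *_) (binomPoly j)) []) d (ι c * leading d)) (sym (ℕP.+-identityʳ j))
    (QL.HasTop-add-left (QL.HasTop-map (ι c *_) (HasTop-binomPoly j)) [] z≤n)
  HasTop-fromBinomial j (x ∷ xs) c = subst (λ d → QL.HasTop (fromBinomialFrom j (x ∷ xs ++ c ∷ [])) d (ι c * leading d)) (sym (ℕP.+-suc j (length xs)))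
    (QL.HasTop-add-right (map (ι x *_) (binomPoly j))
      (ℕP.≤-trans (ℕP.≤-reflexive (trans (LP.length-map (ι x *_) (binomPoly j)) (QL.HasTop-length (HasTop-binomPoly j)))) (s≤s (ℕP.m≤m+n j _)))
      (HasTop-fromBinomial (suc j) xs c))

  HasTop⇒HasDegree : ∀ {p d c} → QL.HasTop p d c → c ≢ 0ℚ → HasDegree p d
  HasTop⇒HasDegree ([] , refl , refl) c≢0 = deg-const c≢0
  HasTop⇒HasDegree (x ∷ xs , refl , refl) c≢0 = deg-suc (HasTop⇒HasDegree (xs , refl , refl) c≢0)

  module ZL = Padded ℤ._+_

  fromBinomial-degree : ∀ {cs d c} → ZL.HasTop cs d c → c ≢ + 0 → HasDegree (fromBinomial cs) d
  fromBinomial-degree (xs , refl , refl) c≢0 =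
    HasTop⇒HasDegree (HasTop-fromBinomial 0 xs _) (*-nonzero _ _ (ι-nonzero _ c≢0) (leading-nonzero (length xs)))

open import Defs
open Peaks using (ValidPeakSet)
open SignedPerms using (count; countPB≡count)
open PeakCounts using (count-valid; count-length)
open Recursion
open Polynomials using (ι; ι-*; eval-fromBinomial; fromBinomial; fromBinomial-integer; fromBinomial-degree)
open import Data.Nat using (ℕ; zero; suc; _≤_; _∸_; _*_; _+_; _^_; _<_; _⊔_; s≤s)
open import Data.Nat.Properties
open import Data.Integer using (+_)
import Data.Integer as ℤ
import Data.Integer.Properties as ℤP
open import Data.Rational using (_/_) renaming (_*_ to _*ℚ_)
open import Data.List using (List; []; _∷_; _++_; length; reverse)
import Data.List.Properties as LP
open import Data.List.Relation.Unary.All as All using (All; []; _∷_)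
open import Data.List.Relation.Unary.Any.Properties using (reverse⁻)
open import Data.List.Relation.Unary.Linked using (Linked)
open import Data.Product using (Σ; _×_; _,_; proj₁; proj₂)
open import Relation.Binary.PropositionalEquality

maxL-snoc : ∀ T m → All (_≤ m) T → maxL (T ++ m ∷ []) ≡ m
maxL-snoc [] m _ = ⊔-identityʳ m
maxL-snoc (t ∷ T) m (t≤m ∷ T≤m) = trans (cong (t ⊔_) (maxL-snoc T m T≤m)) (m≤n⇒m⊔n≡n t≤m)

maxL-reverse : ∀ m R₁ → ValidPeakSet (reverse (m ∷ R₁)) → maxL (reverse (m ∷ R₁)) ≡ m
maxL-reverse m R₁ v = trans (cong maxL (LP.unfold-reverse m R₁))
  (maxL-snoc (reverse R₁) m (All.map (λ p<a → ≤-trans (<⇒≤ p<a) (≤-trans (n≤1+n _) (≤-reflexive a+1≡m))) rest-below))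
  where open LastPeak (lastPeak m R₁ v)

top-below-bound : ∀ R n → 1 ≤ n → All (_< n) R → top R < n
top-below-bound [] n 1≤n _ = 1≤n
top-below-bound (m ∷ _) n _ (m<n ∷ _) = m<n

top-reverse< : ∀ S n → 1 ≤ n → count S n ≢ 0 → top (reverse S) < n
top-reverse< S n 1≤n S≢0 = top-below-bound (reverse S) n 1≤n (All.tabulate (λ p∈ → All.lookup (proj₂ (count-valid S n S≢0)) (reverse⁻ p∈)))

coeffsOf : List ℕ → List ℤ.ℤ
coeffsOf S = coeffs (top (reverse S)) (reverse S)

-- #P_B(S, n) = (Σ_i c_i C(n,i)) · 2^{2n-|S|-1} for n-admissible S:
-- count-formula with the factor 2^{|S|+1} cancelled from 4^n (|S| ≤ n).
count-identity : ∀ S n → 1 ≤ n → count S n ≢ 0 → + count S n ≡ evalBinom (coeffsOf S) n ℤ.* + (2 ^ (2 * n ∸ length S ∸ 1))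
count-identity S n 1≤n S≢0 = ℤP.*-cancelʳ-≡ (+ count S n) (v ℤ.* + (2 ^ e)) (+ (2 ^ suc s)) {{m^n≢0 2 (suc s)}}
  (trans formula (sym (trans (ℤP.*-assoc v (+ (2 ^ e)) (+ (2 ^ suc s)))
    (cong (v ℤ.*_) (trans (sym (ℤP.pos-* (2 ^ e) (2 ^ suc s))) (cong +_ powers))))))
  where
  s = length S
  e = 2 * n ∸ s ∸ 1
  v = evalBinom (coeffsOf S) n
  S-valid : ValidPeakSet S
  S-valid = proj₁ (count-valid S n S≢0)
  formula : + count S n ℤ.* + (2 ^ suc s) ≡ v ℤ.* + pow4 n
  formula = subst₂ (λ U l → + count U n ℤ.* + (2 ^ suc l) ≡ v ℤ.* + pow4 n) (LP.reverse-involutive S) (LP.length-reverse S)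
    (count-formula (top (reverse S)) (reverse S) ≤-refl (subst ValidPeakSet (sym (LP.reverse-involutive S)) S-valid) n (top-reverse< S n 1≤n S≢0))
  s+1≤2n : suc s ≤ 2 * n
  s+1≤2n = ≤-trans (s≤s (count-length S n S≢0)) (≤-trans (≤-reflexive (+-comm 1 n)) (+-monoʳ-≤ n (≤-trans 1≤n (m≤m+n n 0))))
  powers : 2 ^ e * 2 ^ suc s ≡ pow4 n
  powers = begin
      2 ^ e * 2 ^ suc s    ≡⟨ sym (^-distribˡ-+-* 2 e (suc s)) ⟩
      2 ^ (e + suc s)      ≡⟨ cong (λ k → 2 ^ (k + suc s)) (trans (∸-+-assoc (2 * n) s 1) (cong (2 * n ∸_) (+-comm s 1))) ⟩
      2 ^ (2 * n ∸ suc s + suc s) ≡⟨ cong (2 ^_) (m∸n+n≡m s+1≤2n) ⟩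
      2 ^ (2 * n)          ≡⟨ cong (λ k → 2 ^ (n + k)) (+-identityʳ n) ⟩
      2 ^ (n + n)          ≡⟨ ^-distribˡ-+-* 2 n n ⟩
      pow4 n ∎
    where open ≡-Reasoning

-- The polynomial has degree max(S) - 1 (0 for S = ∅): its top binomial
-- coefficient is nonzero by admissibility.
coeffs-degree : ∀ R → ValidPeakSet (reverse R) → ∀ n₀ → top R < n₀ → count (reverse R) n₀ ≢ 0 →
  HasDegree (fromBinomial (coeffs (top R) R)) (maxL (reverse R) ∸ 1)
coeffs-degree [] v _ _ _ = fromBinomial-degree (subst (λ z → ZL.HasTop z 0 (+ 1)) (sym (coeffs-valid 0 [] v)) ([] , refl , refl)) (λ ())
coeffs-degree (zero ∷ R₁) v _ _ _ with LastPeak.a+1≡m (lastPeak 0 R₁ v)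
... | ()
coeffs-degree (suc k ∷ R₁) v n₀ m<n₀ S≢0 = subst (HasDegree (fromBinomial (coeffs (suc k) (suc k ∷ R₁)))) (cong (_∸ 1) (sym (maxL-reverse (suc k) R₁ v)))
  (fromBinomial-degree (coeffs-top k (suc k) R₁ ≤-refl v) (coeffs-top-nonzero k (suc k) R₁ ≤-refl v n₀ m<n₀ S≢0))

coeffsOf-degree : ∀ S n₀ → 1 ≤ n₀ → count S n₀ ≢ 0 → HasDegree (fromBinomial (coeffsOf S)) (maxL S ∸ 1)
coeffsOf-degree S n₀ 1≤n₀ S≢0 = subst (λ U → HasDegree (fromBinomial (coeffsOf S)) (maxL U ∸ 1)) S≡
  (coeffs-degree (reverse S) (subst ValidPeakSet (sym S≡) (proj₁ (count-valid S n₀ S≢0)))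
    n₀ (top-reverse< S n₀ 1≤n₀ S≢0) (subst (λ U → count U n₀ ≢ 0) (sym S≡) S≢0))
  where
  S≡ : reverse (reverse S) ≡ S
  S≡ = LP.reverse-involutive S

polynomial-identity : ∀ S n → 1 ≤ n → count S n ≢ 0 →
  (+ count S n) / 1 ≡ eval (fromBinomial (coeffsOf S)) (+ n / 1) *ℚ ((+ (2 ^ (2 * n ∸ length S ∸ 1))) / 1)
polynomial-identity S n 1≤n S≢0 = begin
    ι (+ count S n)
  ≡⟨ cong ι (count-identity S n 1≤n S≢0) ⟩
    ι (evalBinom (coeffsOf S) n ℤ.* + (2 ^ e))
  ≡⟨ sym (ι-* (evalBinom (coeffsOf S) n) (+ (2 ^ e))) ⟩
    ι (evalBinom (coeffsOf S) n) *ℚ ι (+ (2 ^ e))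
  ≡⟨ cong (_*ℚ ι (+ (2 ^ e))) (sym (eval-fromBinomial 0 (coeffsOf S) n)) ⟩
    eval (fromBinomial (coeffsOf S)) (ι (+ n)) *ℚ ι (+ (2 ^ e)) ∎
  where
  open ≡-Reasoning
  e = 2 * n ∸ length S ∸ 1

theorem2p4 : (S : List ℕ) → Linked _<_ S →
  Σ ℕ (λ n₀ → 1 ≤ n₀ × countPB S n₀ ≢ 0) →
  Σ Poly (λ p → IntegerValued p × HasDegree p (maxL S ∸ 1) ×
    ((n : ℕ) → 1 ≤ n → countPB S n ≢ 0 →
      (+ countPB S n) / 1 ≡ eval p (+ n / 1) *ℚ ((+ (2 ^ (2 * n ∸ length S ∸ 1))) / 1)))
theorem2p4 S _ (n₀ , 1≤n₀ , admissible₀) =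
  fromBinomial (coeffsOf S) ,
  fromBinomial-integer 0 (coeffsOf S) ,
  coeffsOf-degree S n₀ 1≤n₀ (count≢0 n₀ admissible₀) ,
  λ n 1≤n admissible → trans (cong (λ c → (+ c) / 1) (countPB≡count S n)) (polynomial-identity S n 1≤n (count≢0 n admissible))
  where
  count≢0 : ∀ n → countPB S n ≢ 0 → count S n ≢ 0
  count≢0 n ne e = ne (trans (countPB≡count S n) e)
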